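{- Let $k$ be an even positive integer, and let $n,j$ be integers with $2\leq j\leq\frac{n}{2}$. Then $C_n^{\{0,j\}}$ can be embedded in $K_k^*$ if and only if $k\geq4$, $n\leq\frac{k^2}{2}$, and $(k,n,j)\neq(4,8,2)$.
   Context: $K_k^*$ denotes the complete graph $K_k$ on vertices $v_0,\dotsc,v_{k-1}$ with a loop $v_iv_i$ added at every vertex. An embedding of a graph $G$ in $K_k^*$ is a map $f:V(G)\to V(K_k^*)$ such that each edge $uv$ of $G$ is sent to the edge $f(u)f(v)$ of $K_k^*$ (a loop if $f(u)=f(v)$), and the induced map $E(G)\to E(K_k^*)$ is injective. For $2\leq j\leq n/2$, $C_n^{\{0,j\}}$ is the cycle $w_0w_1\dotsb w_{n-1}w_0$ on $n$ vertices together with one chord $w_0w_j$. -}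

module Defs where

open import Data.Nat using (ℕ; zero; suc; _%_; _<_)
open import Data.Nat.DivMod using (m%n<n)
open import Data.Fin using (Fin; toℕ; fromℕ<) renaming (zero to fzero)
open import Data.Product using (_×_; _,_; Σ; proj₁; proj₂)
open import Data.Sum using (_⊎_; inj₁; inj₂)
open import Data.Unit using (⊤; tt)
open import Data.Empty using (⊥)
open import Relation.Binary.PropositionalEquality using (_≡_)

record Graph : Set₁ where
  field
    V     : ℕ
    Edge  : Set
    ends  : Edge → Fin V × Fin V

-- Edges of K_k^* are unordered pairs {a,b} of vertices of Fin k, a = b allowed
-- (loops).  Two ordered pairs denote the same edge of K_k^* iff they agree
-- up to swapping.
SameEdge : ∀ {k} → Fin k × Fin k → Fin k × Fin k → Set
SameEdge (a , b) (c , d) = (a ≡ c × b ≡ d) ⊎ (a ≡ d × b ≡ c)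

EmbedsIn : Graph → ℕ → Set
EmbedsIn G k =
  Σ (Fin (Graph.V G) → Fin k) λ f →
    ∀ e e' →
      SameEdge (f (proj₁ (Graph.ends G e)) , f (proj₂ (Graph.ends G e)))
               (f (proj₁ (Graph.ends G e')) , f (proj₂ (Graph.ends G e'))) →
      e ≡ e'

w : (m a : ℕ) → Fin (suc m)
w m a = fromℕ< (m%n<n a (suc m))

-- C_n^{0,j} for n = suc m: vertices w_0..w_{n-1}; cycle edges w_i w_{i+1 mod n}
-- (indexed by inj₁ i, i : Fin n) and the chord w_0 w_j (indexed by inj₂ tt).
-- For n = 0 (excluded by the hypotheses) we take the empty graph.
C : (n j : ℕ) → Graph
C zero j = record { V = zero ; Edge = ⊥ ; ends = λ () }
C (suc m) j = record
  { V = suc m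
  ; Edge = Fin (suc m) ⊎ ⊤
  ; ends = λ { (inj₁ i) → (w m (toℕ i) , w m (suc (toℕ i)))
             ; (inj₂ _) → (w m 0 , w m j) }
  }

-- Along a closed trail every visit of a vertex v uses two edge-ends at v, while the edges
-- of K_k^* at v carry k + 1 edge-ends (the loop counts twice).  As k is even, v is visited at most
-- k/2 times, so the n cycle edges give 2n ≤ k².  Then k = 2 is impossible since n ≥ 4, and an
-- exhaustive search shows that C₈^{0,2} does not embed in K₄^*.
--
-- Embeddings with w₀ ↦ 0 and w_j ↦ 1 are closed trails from 0 avoiding the edge 01
-- whose j-th vertex is 1.  A trail in K_{2m}^* is extended to K_{2m+2}^* by splicing in, at its end
-- or at its start, a detour through the two new vertices that zigzags over the old ones; its length
-- can be any 4(t+1) + r with r ≤ 2 and t < m, which reaches every n ≤ 2(m+1)².  For m ≥ 6 one of the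
-- two splicings always keeps the chord admissible; the finitely many other cases, k ≤ 12, are
-- settled by trails found by computer.

module Submission where

open import Defs
open import Data.Bool using (Bool; T; if_then_else_; _∧_; _∨_)
open import Data.Bool.Properties using (T-∧; T-∨)
open import Data.Fin using (Fin; toℕ; fromℕ<; #_)
open import Data.Fin.Properties using (toℕ-fromℕ<; toℕ-injective; toℕ<n)
import Data.Fin.Properties as Fin
open import Data.List using (List; []; _∷_; length; _++_; reverseAcc)
open import Data.List.Properties using (length-++)
open import Data.List.Relation.Binary.Disjoint.Propositional using (Disjoint)
import Data.List.Relation.Binary.Disjoint.Propositional.Properties as Disjoint
open import Data.List.Relation.Unary.All using (All; []; _∷_; all?)
import Data.List.Relation.Unary.All as All
import Data.List.Relation.Unary.All.Properties as All
open import Data.List.Relation.Unary.Unique.Propositional using (Unique; []; _∷_)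
open import Data.List.Relation.Unary.Unique.Propositional.Properties using (++⁺; drop⁺; map⁺)
import Data.List.Relation.Unary.Unique.DecPropositional as DecUnique
open import Data.Nat using (ℕ; zero; suc; _+_; _*_; _∸_; _≤_; _<_; _≤?_; _⊓_; _⊔_; z≤n; s≤s; s≤s⁻¹; _%_; _≡ᵇ_)
open import Data.Nat.DivMod using (m%n<n; m≤n⇒m%n≡m; n%n≡0)
open import Data.Nat.Divisibility using (_∣_; divides)
open import Data.Nat.Properties
open import Algebra.Properties.CommutativeSemigroup +-commutativeSemigroup using (interchange; xy∙z≈xz∙y)
open import Data.Nat.Tactic.RingSolver using (solve-∀)
open import Data.Product using (_×_; _,_; proj₁; proj₂; map₁)
open import Data.Product.Properties using (,-injectiveˡ; ,-injectiveʳ)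
import Data.Product.Properties as Product
open import Data.Sum using (_⊎_; inj₁; inj₂; [_,_]′)
open import Data.Sum.Properties using (inj₁-injective)
import Data.Sum.Properties as Sum
open import Data.Unit using (⊤; tt)
import Data.Unit.Properties as Unit
open import Function using (_∘_)
open import Function.Bundles using (Equivalence; _⇔_; mk⇔)
open import Relation.Binary.Definitions using (DecidableEquality)
open import Relation.Binary.PropositionalEquality
open import Relation.Nullary using (¬_; Dec; yes; no; ¬?; contradiction)
open import Relation.Nullary.Decidable using (_×-dec_; _⊎-dec_; _→-dec_; isYes; toWitness)

open Equivalence using (to)

-- An edge of K_k^* with ends a and b, normalised so that edge a b ≡ edge b a.
edge : ℕ → ℕ → ℕ × ℕ
edge a b = (a ⊓ b , a ⊔ b)

_≟ₑ_ : (e e′ : ℕ × ℕ) → Dec (e ≡ e′)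
_≟ₑ_ = Product.≡-dec _≟_ _≟_

edge-comm : ∀ a b → edge a b ≡ edge b a
edge-comm a b = cong₂ _,_ (⊓-comm a b) (⊔-comm a b)

edge-≤ : ∀ {a b} → a ≤ b → edge a b ≡ (a , b)
edge-≤ a≤b = cong₂ _,_ (m≤n⇒m⊓n≡m a≤b) (m≤n⇒m⊔n≡n a≤b)

edge-≥ : ∀ {a b} → b ≤ a → edge a b ≡ (b , a)
edge-≥ b≤a = cong₂ _,_ (m≥n⇒m⊓n≡n b≤a) (m≥n⇒m⊔n≡m b≤a)

edge-injective : ∀ {a b c d} → edge a b ≡ edge c d → (a ≡ c × b ≡ d) ⊎ (a ≡ d × b ≡ c)
edge-injective {a} {b} {c} {d} eq with ≤-total a b | ≤-total c d
... | inj₁ a≤b | inj₁ c≤d with trans (sym (edge-≤ a≤b)) (trans eq (edge-≤ c≤d))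
...   | refl = inj₁ (refl , refl)
edge-injective eq | inj₁ a≤b | inj₂ d≤c with trans (sym (edge-≤ a≤b)) (trans eq (edge-≥ d≤c))
...   | refl = inj₂ (refl , refl)
edge-injective eq | inj₂ b≤a | inj₁ c≤d with trans (sym (edge-≥ b≤a)) (trans eq (edge-≤ c≤d))
...   | refl = inj₂ (refl , refl)
edge-injective eq | inj₂ b≤a | inj₂ d≤c with trans (sym (edge-≥ b≤a)) (trans eq (edge-≥ d≤c))
...   | refl = inj₁ (refl , refl)

SameEdge⇒edge≡ : ∀ {k} {a b c d : Fin k} → SameEdge (a , b) (c , d) → edge (toℕ a) (toℕ b) ≡ edge (toℕ c) (toℕ d)
SameEdge⇒edge≡ (inj₁ (refl , refl)) = refl
SameEdge⇒edge≡ {a = a} {b} (inj₂ (refl , refl)) = edge-comm (toℕ a) (toℕ b)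

edge≡⇒SameEdge : ∀ {k} {a b c d : Fin k} → edge (toℕ a) (toℕ b) ≡ edge (toℕ c) (toℕ d) → SameEdge (a , b) (c , d)
edge≡⇒SameEdge eq with edge-injective eq
... | inj₁ (p , q) = inj₁ (toℕ-injective p , toℕ-injective q)
... | inj₂ (p , q) = inj₂ (toℕ-injective p , toℕ-injective q)

SameEdge-sym : ∀ {k} {e e′ : Fin k × Fin k} → SameEdge e e′ → SameEdge e′ e
SameEdge-sym (inj₁ (refl , refl)) = inj₁ (refl , refl)
SameEdge-sym (inj₂ (refl , refl)) = inj₂ (refl , refl)

nth : {A : Set} → A → List A → ℕ → A
nth d []       _       = d
nth d (x ∷ xs) zero    = x
nth d (x ∷ xs) (suc i) = nth d xs i

All-nth : ∀ {A : Set} {P : A → Set} {d xs i} → All P xs → i < length xs → P (nth d xs i)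
All-nth {i = zero}  (p ∷ _)  _         = p
All-nth {i = suc i} (_ ∷ ps) (s≤s i<n) = All-nth ps i<n

nth-injective : ∀ {A : Set} {d : A} {xs i i′} → Unique xs → i < length xs → i′ < length xs →
  nth d xs i ≡ nth d xs i′ → i ≡ i′
nth-injective {i = zero}  {zero}   _        _         _          _  = refl
nth-injective {i = zero}  {suc i′} (x∉ ∷ _) _         (s≤s i′<n) eq = contradiction eq (All-nth x∉ i′<n)
nth-injective {i = suc i} {zero}   (x∉ ∷ _) (s≤s i<n) _          eq = contradiction (sym eq) (All-nth x∉ i<n)
nth-injective {i = suc i} {suc i′} (_ ∷ u)  (s≤s i<n) (s≤s i′<n) eq = cong suc (nth-injective u i<n i′<n eq)

endpoint : ℕ → List ℕ → ℕ
endpoint a []       = a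
endpoint _ (b ∷ bs) = endpoint b bs

nth-length : ∀ {d : ℕ} a xs → nth d (a ∷ xs) (length xs) ≡ endpoint a xs
nth-length a []       = refl
nth-length a (b ∷ bs) = nth-length b bs

endpoint-++ : ∀ a xs ys → endpoint a (xs ++ ys) ≡ endpoint (endpoint a xs) ys
endpoint-++ a []       ys = refl
endpoint-++ a (b ∷ bs) ys = endpoint-++ b bs ys

nth-++ˡ : ∀ {A : Set} {d : A} a xs ys {i} → i ≤ length xs → nth d (a ∷ xs ++ ys) i ≡ nth d (a ∷ xs) i
nth-++ˡ a xs       ys {zero}  _         = refl
nth-++ˡ a (x ∷ xs) ys {suc i} (s≤s i≤n) = nth-++ˡ x xs ys i≤n

nth-++ʳ : ∀ {d : ℕ} a xs ys i → nth d (a ∷ xs ++ ys) (length xs + i) ≡ nth d (endpoint a xs ∷ ys) i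
nth-++ʳ a []       ys i = refl
nth-++ʳ a (x ∷ xs) ys i = nth-++ʳ x xs ys i

walkEdges : ℕ → List ℕ → List (ℕ × ℕ)
walkEdges a []       = []
walkEdges a (b ∷ bs) = edge a b ∷ walkEdges b bs

length-walkEdges : ∀ a bs → length (walkEdges a bs) ≡ length bs
length-walkEdges a []       = refl
length-walkEdges a (b ∷ bs) = cong suc (length-walkEdges b bs)

walkEdges-++ : ∀ a xs ys → walkEdges a (xs ++ ys) ≡ walkEdges a xs ++ walkEdges (endpoint a xs) ys
walkEdges-++ a []       ys = refl
walkEdges-++ a (x ∷ xs) ys = cong (edge a x ∷_) (walkEdges-++ x xs ys)

nth-walkEdges : ∀ {d} a bs {i} → i < length bs →
  nth d (walkEdges a bs) i ≡ edge (nth 0 (a ∷ bs) i) (nth 0 (a ∷ bs) (suc i))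
nth-walkEdges a (b ∷ bs) {zero}  _         = refl
nth-walkEdges a (b ∷ bs) {suc i} (s≤s i<n) = nth-walkEdges b bs i<n

walkEdges-below : ∀ {k a bs} → a < k → All (_< k) bs → All (λ e → proj₂ e < k) (walkEdges a bs)
walkEdges-below a<k []           = []
walkEdges-below a<k (b<k ∷ bs<k) = ⊔-lub a<k b<k ∷ walkEdges-below b<k bs<k

infix 5 ∑-syntax

∑ : ℕ → (ℕ → ℕ) → ℕ
∑ zero    f = 0
∑ (suc n) f = ∑ n f + f n

∑-syntax : ℕ → (ℕ → ℕ) → ℕ
∑-syntax = ∑

syntax ∑-syntax n (λ i → x) = ∑[ i < n ] x

∑-cong : ∀ n {f g} → (∀ {i} → i < n → f i ≡ g i) → ∑ n f ≡ ∑ n g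
∑-cong zero    eq = refl
∑-cong (suc n) eq = cong₂ _+_ (∑-cong n (λ i<n → eq (m<n⇒m<1+n i<n))) (eq ≤-refl)

∑-mono-≤ : ∀ n {f g} → (∀ {i} → i < n → f i ≤ g i) → ∑ n f ≤ ∑ n g
∑-mono-≤ zero    le = z≤n
∑-mono-≤ (suc n) le = +-mono-≤ (∑-mono-≤ n (λ i<n → le (m<n⇒m<1+n i<n))) (le ≤-refl)

∑-zero : ∀ n {f} → (∀ {i} → i < n → f i ≡ 0) → ∑ n f ≡ 0
∑-zero zero    eq = refl
∑-zero (suc n) eq = cong₂ _+_ (∑-zero n (λ i<n → eq (m<n⇒m<1+n i<n))) (eq ≤-refl)

∑-const : ∀ n c → ∑[ i < n ] c ≡ n * c
∑-const zero    c = refl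
∑-const (suc n) c = trans (cong (_+ c) (∑-const n c)) (+-comm (n * c) c)

∑-distrib-+ : ∀ n f g → ∑[ i < n ] (f i + g i) ≡ ∑ n f + ∑ n g
∑-distrib-+ zero    f g = refl
∑-distrib-+ (suc n) f g = trans (cong (_+ (f n + g n)) (∑-distrib-+ n f g)) (interchange (∑ n f) (∑ n g) (f n) (g n))

∑-distribʳ-* : ∀ n f c → ∑[ i < n ] (f i * c) ≡ ∑ n f * c
∑-distribʳ-* zero    f c = refl
∑-distribʳ-* (suc n) f c = trans (cong (_+ f n * c) (∑-distribʳ-* n f c)) (sym (*-distribʳ-+ c (∑ n f) (f n)))

∑-comm : ∀ m n (f : ℕ → ℕ → ℕ) → ∑[ i < m ] ∑[ j < n ] f i j ≡ ∑[ j < n ] ∑[ i < m ] f i j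
∑-comm zero    n f = sym (∑-zero n (λ _ → refl))
∑-comm (suc m) n f = trans (cong (_+ ∑ n (f m)) (∑-comm m n f)) (sym (∑-distrib-+ n (λ j → ∑[ i < m ] f i j) (f m)))

∑-concentrated : ∀ n {f} c → c < n → (∀ {i} → i < n → i ≢ c → f i ≡ 0) → ∑ n f ≡ f c
∑-concentrated (suc n) {f} c c<1+n zero-off-c with c ≟ n
... | yes refl = cong (_+ f c) (∑-zero n (λ i<n → zero-off-c (m<n⇒m<1+n i<n) (<⇒≢ i<n)))
... | no c≢n = begin
  ∑ n f + f n ≡⟨ cong₂ _+_ (∑-concentrated n c (≤∧≢⇒< (s≤s⁻¹ c<1+n) c≢n) (λ i<n → zero-off-c (m<n⇒m<1+n i<n)))
                           (zero-off-c ≤-refl (≢-sym c≢n)) ⟩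
  f c + 0     ≡⟨ +-identityʳ (f c) ⟩
  f c         ∎
  where open ≡-Reasoning

∑-rotate : ∀ n f → ∑ n (f ∘ suc) + f 0 ≡ ∑ n f + f n
∑-rotate zero    f = refl
∑-rotate (suc n) f = trans (xy∙z≈xz∙y (∑ n (f ∘ suc)) (f (suc n)) (f 0)) (cong (_+ f (suc n)) (∑-rotate n f))

𝟙 : {A : Set} → Dec A → ℕ
𝟙 (yes _) = 1
𝟙 (no _)  = 0

𝟙-yes : {A : Set} (a? : Dec A) → A → 𝟙 a? ≡ 1
𝟙-yes (yes _) _ = refl
𝟙-yes (no ¬a) a = contradiction a ¬a

𝟙-no : {A : Set} (a? : Dec A) → ¬ A → 𝟙 a? ≡ 0
𝟙-no (yes a) ¬a = contradiction a ¬a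
𝟙-no (no _)  _  = refl

∑-𝟙-point : ∀ n {a} → a < n → ∑[ v < n ] 𝟙 (a ≟ v) ≡ 1
∑-𝟙-point n {a} a<n = trans (∑-concentrated n a a<n (λ _ v≢a → 𝟙-no (a ≟ _) (v≢a ∘ sym))) (𝟙-yes (a ≟ a) refl)

∑-𝟙-injective : ∀ {A : Set} (_≟_ : DecidableEquality A) n (f : ℕ → A) →
  (∀ {i i′} → i < n → i′ < n → f i ≡ f i′ → i ≡ i′) → ∀ c → ∑[ i < n ] 𝟙 (f i ≟ c) ≤ 1
∑-𝟙-injective _≟_ zero    f injective c = z≤n
∑-𝟙-injective _≟_ (suc n) f injective c with f n ≟ c
... | yes refl = ≤-reflexive (cong (_+ 1) (∑-zero n λ i<n →
        𝟙-no (f _ ≟ f n) (λ eq → <⇒≢ i<n (injective (m<n⇒m<1+n i<n) ≤-refl eq))))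
... | no _ = ≤-trans (≤-reflexive (+-identityʳ _))
                     (∑-𝟙-injective _≟_ n f (λ i<n i′<n → injective (m<n⇒m<1+n i<n) (m<n⇒m<1+n i′<n)) c)

-- In K_k^* the loop at v counts twice towards the degree of v.
loopWeight : ℕ → ℕ → ℕ
loopWeight v u = 1 + 𝟙 (v ≟ u)

module _ {k : ℕ} (v a b : ℕ) where

  private
    ends : ∀ u → edge a b ≡ edge v u → (a ≡ v × b ≡ u) ⊎ (a ≡ u × b ≡ v)
    ends u = edge-injective {a} {b} {v} {u}

    only : ∀ c → c < k → (∀ u → edge a b ≡ edge v u → c ≡ u) →
           ∑[ u < k ] (𝟙 (edge a b ≟ₑ edge v u) * loopWeight v u) ≡ 𝟙 (edge a b ≟ₑ edge v c) * loopWeight v c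
    only c c<k hits-c = ∑-concentrated k c c<k λ {u} _ u≢c → cong (_* _) (𝟙-no (_ ≟ₑ _) λ eq → u≢c (sym (hits-c u eq)))

  incidence≡∑ : a < k → b < k →
    𝟙 (a ≟ v) + 𝟙 (b ≟ v) ≡ ∑[ u < k ] (𝟙 (edge a b ≟ₑ edge v u) * loopWeight v u)
  incidence≡∑ a<k b<k with a ≟ v | b ≟ v
  ... | yes refl | yes refl = sym (trans (only a a<k λ u eq → [ proj₂ , proj₁ ]′ (ends u eq))
                                         (cong₂ _*_ (𝟙-yes (edge v v ≟ₑ edge v v) refl) (cong suc (𝟙-yes (v ≟ v) refl))))
  ... | yes refl | no b≢a = sym (trans (only b b<k λ u eq → [ proj₂ , (λ (_ , e) → contradiction e b≢a) ]′ (ends u eq))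
                                       (cong₂ _*_ (𝟙-yes (edge v b ≟ₑ edge v b) refl) (cong suc (𝟙-no (v ≟ b) (b≢a ∘ sym)))))
  ... | no a≢b | yes refl = sym (trans (only a a<k λ u eq → [ (λ (e , _) → contradiction e a≢b) , proj₁ ]′ (ends u eq))
                                       (cong₂ _*_ (𝟙-yes (edge a v ≟ₑ edge v a) (edge-comm a v)) (cong suc (𝟙-no (v ≟ a) (a≢b ∘ sym)))))
  ... | no a≢v | no b≢v = sym (∑-zero k λ {u} _ → cong (_* _) (𝟙-no (_ ≟ₑ _) λ eq →
                                [ (λ (e , _) → a≢v e) , (λ (_ , e) → b≢v e) ]′ (ends u eq)))

module ClosedWalk {k n : ℕ} (t : ℕ → ℕ) (t<k : ∀ i → t i < k) (closed : t n ≡ t 0)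
  (trail : ∀ {i i′} → i < n → i′ < n → edge (t i) (t (suc i)) ≡ edge (t i′) (t (suc i′)) → i ≡ i′) where

  visits : ℕ → ℕ
  visits v = ∑[ i < n ] 𝟙 (t i ≟ v)

  degree : ℕ → ℕ
  degree v = ∑[ i < n ] (𝟙 (t i ≟ v) + 𝟙 (t (suc i) ≟ v))

  degree≡2*visits : ∀ v → degree v ≡ 2 * visits v
  degree≡2*visits v = begin
    degree v                                  ≡⟨ ∑-distrib-+ n (λ i → 𝟙 (t i ≟ v)) (λ i → 𝟙 (t (suc i) ≟ v)) ⟩
    visits v + (∑[ i < n ] 𝟙 (t (suc i) ≟ v)) ≡⟨ cong (visits v +_) shifted ⟩
    visits v + visits v                       ≡⟨ cong (visits v +_) (sym (+-identityʳ (visits v))) ⟩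
    2 * visits v                              ∎
    where
    open ≡-Reasoning
    shifted : ∑[ i < n ] 𝟙 (t (suc i) ≟ v) ≡ visits v
    shifted = +-cancelʳ-≡ _ _ _ (trans (∑-rotate n (λ i → 𝟙 (t i ≟ v))) (cong (λ x → visits v + 𝟙 (x ≟ v)) closed))

  degree≤k+1 : ∀ {v} → v < k → degree v ≤ k + 1
  degree≤k+1 {v} v<k = begin
    degree v                                   ≡⟨ ∑-cong n (λ {i} _ → incidence≡∑ v (t i) (t (suc i)) (t<k i) (t<k (suc i))) ⟩
    ∑[ i < n ] ∑[ u < k ] (hit i u * weight u) ≡⟨ ∑-comm n k _ ⟩
    ∑[ u < k ] ∑[ i < n ] (hit i u * weight u) ≡⟨ ∑-cong k (λ {u} _ → ∑-distribʳ-* n _ (weight u)) ⟩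
    ∑[ u < k ] (uses (edge v u) * weight u)    ≤⟨ ∑-mono-≤ k (λ {u} _ → *-monoˡ-≤ (weight u) (uses≤1 (edge v u))) ⟩
    ∑[ u < k ] (1 * weight u)                  ≡⟨ ∑-cong k (λ {u} _ → *-identityˡ (weight u)) ⟩
    ∑[ u < k ] (1 + 𝟙 (v ≟ u))                 ≡⟨ ∑-distrib-+ k (λ _ → 1) (λ u → 𝟙 (v ≟ u)) ⟩
    (∑[ u < k ] 1) + (∑[ u < k ] 𝟙 (v ≟ u))    ≡⟨ cong₂ _+_ (trans (∑-const k 1) (*-identityʳ k)) (∑-𝟙-point k v<k) ⟩
    k + 1                                      ∎
    where
    open ≤-Reasoning
    step : ℕ → ℕ × ℕ
    step i = edge (t i) (t (suc i))
    hit : ℕ → ℕ → ℕ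
    hit i u = 𝟙 (step i ≟ₑ edge v u)
    weight : ℕ → ℕ
    weight = loopWeight v
    uses : ℕ × ℕ → ℕ
    uses c = ∑[ i < n ] 𝟙 (step i ≟ₑ c)
    uses≤1 : ∀ c → uses c ≤ 1
    uses≤1 = ∑-𝟙-injective _≟ₑ_ n step trail

  2*visits≤k : 2 ∣ k → ∀ {v} → v < k → 2 * visits v ≤ k
  2*visits≤k (divides q refl) {v} v<k = ≤-trans (*-monoʳ-≤ 2 visits≤q) (≤-reflexive (*-comm 2 q))
    where
    visits≤q : visits v ≤ q
    visits≤q = s≤s⁻¹ (*-cancelˡ-< 2 (visits v) (suc q) (begin-strict
      2 * visits v ≡⟨ sym (degree≡2*visits v) ⟩
      degree v     ≤⟨ degree≤k+1 v<k ⟩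
      q * 2 + 1    ≡⟨ +-comm (q * 2) 1 ⟩
      1 + q * 2    <⟨ n<1+n (1 + q * 2) ⟩
      2 + q * 2    ≡⟨ trans (cong (2 +_) (*-comm q 2)) (sym (*-suc 2 q)) ⟩
      2 * suc q    ∎))
      where open ≤-Reasoning

  ∑-degree : ∑[ v < k ] degree v ≡ n * 2
  ∑-degree = begin
    ∑[ v < k ] degree v                                     ≡⟨ sym (∑-comm n k _) ⟩
    ∑[ i < n ] ∑[ v < k ] (𝟙 (t i ≟ v) + 𝟙 (t (suc i) ≟ v)) ≡⟨ ∑-cong n (λ {i} _ → ∑-distrib-+ k _ _) ⟩
    ∑[ i < n ] (spread (t i) + spread (t (suc i)))          ≡⟨ ∑-cong n (λ {i} _ → cong₂ _+_ (∑-𝟙-point k (t<k i)) (∑-𝟙-point k (t<k (suc i)))) ⟩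
    ∑[ i < n ] 2                                            ≡⟨ ∑-const n 2 ⟩
    n * 2                                                   ∎
    where
    open ≡-Reasoning
    spread : ℕ → ℕ
    spread a = ∑[ v < k ] 𝟙 (a ≟ v)

  length-bound : 2 ∣ k → 2 * n ≤ k * k
  length-bound 2∣k = begin
    2 * n               ≡⟨ *-comm 2 n ⟩
    n * 2               ≡⟨ sym ∑-degree ⟩
    ∑[ v < k ] degree v ≤⟨ ∑-mono-≤ k (λ v<k → ≤-trans (≤-reflexive (degree≡2*visits _)) (2*visits≤k 2∣k v<k)) ⟩
    ∑[ v < k ] k        ≡⟨ ∑-const k k ⟩
    k * k               ∎
    where open ≤-Reasoning

w-closed : ∀ m → w m (suc m) ≡ w m 0
w-closed m = toℕ-injective (begin
  toℕ (w m (suc m)) ≡⟨ toℕ-fromℕ< (m%n<n (suc m) (suc m)) ⟩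
  suc m % suc m     ≡⟨ n%n≡0 (suc m) ⟩
  0                 ≡⟨ toℕ-fromℕ< (m%n<n 0 (suc m)) ⟨
  toℕ (w m 0)       ∎)
  where open ≡-Reasoning

EmbedsIn⇒2n≤k² : ∀ {k n j} → 2 ∣ k → EmbedsIn (C n j) k → 2 * n ≤ k * k
EmbedsIn⇒2n≤k² {n = zero} _ _ = z≤n
EmbedsIn⇒2n≤k² {k} {suc m} 2∣k (f , injective) = ClosedWalk.length-bound {k} {suc m} t (λ i → toℕ<n (f (w m i))) closed trail 2∣k
  where
  t : ℕ → ℕ
  t i = toℕ (f (w m i))
  step : ℕ → ℕ × ℕ
  step i = edge (t i) (t (suc i))
  closed : t (suc m) ≡ t 0
  closed = cong (toℕ ∘ f) (w-closed m)
  trail : ∀ {i i′} → i < suc m → i′ < suc m → step i ≡ step i′ → i ≡ i′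
  trail {i} {i′} i<n i′<n eq = begin
    i                ≡⟨ toℕ-fromℕ< i<n ⟨
    toℕ (fromℕ< i<n) ≡⟨ cong toℕ (inj₁-injective (injective (inj₁ (fromℕ< i<n)) (inj₁ (fromℕ< i′<n)) (edge≡⇒SameEdge
                            (trans (cong step (toℕ-fromℕ< i<n)) (trans eq (sym (cong step (toℕ-fromℕ< i′<n)))))))) ⟩
    toℕ (fromℕ< i′<n) ≡⟨ toℕ-fromℕ< i′<n ⟩
    i′                ∎
    where open ≡-Reasoning

-- A prefix t₀ … tᵣ of the closed walk of C₈^{0,2} is stored reversed, as tᵣ ∷ … ∷ t₀;
-- its edge list contains the chord t₀t₂ as soon as t₂ is known.
pathEdges : List ℕ → List (ℕ × ℕ)
pathEdges (c ∷ b ∷ a ∷ [])         = edge b c ∷ edge a c ∷ edge a b ∷ []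
pathEdges (y ∷ x ∷ rest@(_ ∷ _ ∷ _)) = edge x y ∷ pathEdges (x ∷ rest)
pathEdges (b ∷ a ∷ [])             = edge a b ∷ []
pathEdges _                        = []

closedEdges : List ℕ → List (ℕ × ℕ)
closedEdges []       = []
closedEdges (x ∷ rv) = edge x (endpoint x rv) ∷ pathEdges (x ∷ rv)

Unique-pathEdges-∷ : ∀ x rv → Unique (pathEdges (x ∷ rv)) → Unique (pathEdges rv)
Unique-pathEdges-∷ x []              _       = []
Unique-pathEdges-∷ x (_ ∷ [])        _       = []
Unique-pathEdges-∷ x (_ ∷ _ ∷ [])     u       = drop⁺ 2 u
Unique-pathEdges-∷ x (_ ∷ _ ∷ _ ∷ _)  (_ ∷ u) = u

Unique-closedEdges⇒pathEdges : ∀ rv xs → Unique (closedEdges (reverseAcc rv xs)) → Unique (pathEdges rv)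
Unique-closedEdges⇒pathEdges []       []       _       = []
Unique-closedEdges⇒pathEdges (x ∷ rv) []       (_ ∷ u) = u
Unique-closedEdges⇒pathEdges rv       (x ∷ xs) u       =
  Unique-pathEdges-∷ x rv (Unique-closedEdges⇒pathEdges (x ∷ rv) xs u)

Repeats : List (ℕ × ℕ) → Bool
Repeats es = isYes (¬? (DecUnique.unique? _≟ₑ_ es))

∀<4 : (ℕ → Bool) → Bool
∀<4 p = p 0 ∧ p 1 ∧ p 2 ∧ p 3

∀<4-sound : ∀ p → T (∀<4 p) → ∀ {y} → y < 4 → T (p y)
∀<4-sound p h {0} _ = proj₁ (to (T-∧ {p 0}) h)
∀<4-sound p h {1} _ = proj₁ (to (T-∧ {p 1}) (proj₂ (to (T-∧ {p 0}) h)))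
∀<4-sound p h {2} _ = proj₁ (to (T-∧ {p 2}) (proj₂ (to (T-∧ {p 1}) (proj₂ (to (T-∧ {p 0}) h)))))
∀<4-sound p h {3} _ = proj₂ (to (T-∧ {p 2}) (proj₂ (to (T-∧ {p 1}) (proj₂ (to (T-∧ {p 0}) h)))))
∀<4-sound p h {suc (suc (suc (suc _)))} (s≤s (s≤s (s≤s (s≤s ()))))

hopeless : ℕ → List ℕ → Bool
hopeless zero    rv = Repeats (closedEdges rv)
hopeless (suc r) rv = Repeats (pathEdges rv) ∨ ∀<4 (λ x → hopeless r (x ∷ rv))

hopeless-sound : ∀ r rv → T (hopeless r rv) →
  ∀ xs → length xs ≡ r → All (_< 4) xs → ¬ Unique (closedEdges (reverseAcc rv xs))
hopeless-sound zero    rv h []       _    _           = toWitness h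
hopeless-sound (suc r) rv h (x ∷ xs) refl (x<4 ∷ xs<4) u with to (T-∨ {Repeats (pathEdges rv)}) h
... | inj₁ repeats = toWitness repeats (Unique-closedEdges⇒pathEdges rv (x ∷ xs) u)
... | inj₂ all4    = hopeless-sound r (x ∷ rv) (∀<4-sound (λ y → hopeless r (y ∷ rv)) all4 x<4) xs refl xs<4 u

no-C₈₂-walk : ∀ xs → length xs ≡ 8 → All (_< 4) xs → ¬ Unique (closedEdges (reverseAcc [] xs))
no-C₈₂-walk = hopeless-sound 8 [] _

no-C₈₂-embedding : ¬ EmbedsIn (C 8 2) 4
no-C₈₂-embedding (f , injective) = no-C₈₂-walk (t 0 ∷ t 1 ∷ t 2 ∷ t 3 ∷ t 4 ∷ t 5 ∷ t 6 ∷ t 7 ∷ []) refl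
  (t<4 0 ∷ t<4 1 ∷ t<4 2 ∷ t<4 3 ∷ t<4 4 ∷ t<4 5 ∷ t<4 6 ∷ t<4 7 ∷ []) (map⁺ image-injective graphEdges-distinct)
  where
  t : ℕ → ℕ
  t i = toℕ (f (w 7 i))
  t<4 : ∀ i → t i < 4
  t<4 i = toℕ<n (f (w 7 i))
  image : Fin 8 ⊎ ⊤ → ℕ × ℕ
  image e = edge (toℕ (f (proj₁ (Graph.ends (C 8 2) e)))) (toℕ (f (proj₂ (Graph.ends (C 8 2) e))))
  image-injective : ∀ {e e′} → image e ≡ image e′ → e ≡ e′
  image-injective eq = injective _ _ (edge≡⇒SameEdge eq)
  -- In the order in which closedEdges lists their images, so that map image graphEdges reduces to it.
  graphEdges : List (Fin 8 ⊎ ⊤)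
  graphEdges = inj₁ (# 7) ∷ inj₁ (# 6) ∷ inj₁ (# 5) ∷ inj₁ (# 4) ∷ inj₁ (# 3) ∷ inj₁ (# 2) ∷ inj₁ (# 1) ∷
               inj₂ tt ∷ inj₁ (# 0) ∷ []
  graphEdges-distinct : Unique graphEdges
  graphEdges-distinct = toWitness {a? = DecUnique.unique? (Sum.≡-dec Fin._≟_ Unit._≟_) graphEdges} _

-- A closed trail 0 = t₀, t₁, …, tₙ = 0 in K_k^* with t_j = 1 that avoids the edge 01; route lists
-- t₁ … tₙ.  Mapping wᵢ ↦ tᵢ, such a trail is an embedding of C_n^{0,j} sending the chord to 01.
record ClosedTrail (k n j : ℕ) : Set where
  field
    route      : List ℕ
    length≡n   : length route ≡ n
    returns    : endpoint 0 route ≡ 0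
    bounded    : All (_< k) route
    distinct   : Unique (walkEdges 0 route)
    avoids-01  : All (_≢ (0 , 1)) (walkEdges 0 route)
    reaches-1  : nth 0 (0 ∷ route) j ≡ 1

  vertex : ℕ → ℕ
  vertex = nth 0 (0 ∷ route)

ClosedTrail-mono : ∀ {k k′ n j} → k ≤ k′ → ClosedTrail k n j → ClosedTrail k′ n j
ClosedTrail-mono k≤k′ T = record
  { route = route ; length≡n = length≡n ; returns = returns ; bounded = All.map (λ v<k → ≤-trans v<k k≤k′) bounded
  ; distinct = distinct ; avoids-01 = avoids-01 ; reaches-1 = reaches-1 }
  where open ClosedTrail T

ClosedTrail⇒EmbedsIn : ∀ {k n j} → 0 < k → j < n → ClosedTrail k n j → EmbedsIn (C n j) k
ClosedTrail⇒EmbedsIn {k} {suc m} {j} 0<k j<n T = f , injective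
  where
  open ClosedTrail T
  n : ℕ
  n = suc m
  f : Fin n → Fin k
  f x = fromℕ< (All-nth {i = toℕ x} (0<k ∷ bounded) (m<n⇒m<1+n (subst (toℕ x <_) (sym length≡n) (toℕ<n x))))
  vertex-% : ∀ {a} → a ≤ n → vertex (a % n) ≡ vertex a
  vertex-% a≤n with m≤n⇒m<n∨m≡n a≤n
  ... | inj₁ a<n  = cong vertex (m≤n⇒m%n≡m (s≤s⁻¹ a<n))
  ... | inj₂ refl = trans (cong vertex (n%n≡0 n)) (sym (trans (cong vertex (sym length≡n)) (trans (nth-length 0 route) returns)))
  f-w : ∀ {a} → a ≤ n → toℕ (f (w m a)) ≡ vertex a
  f-w {a} a≤n = trans (toℕ-fromℕ< _) (trans (cong vertex (toℕ-fromℕ< (m%n<n a n))) (vertex-% a≤n))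
  i<route : ∀ (i : Fin n) → toℕ i < length route
  i<route i = subst (toℕ i <_) (sym length≡n) (toℕ<n i)
  i<length : ∀ (i : Fin n) → toℕ i < length (walkEdges 0 route)
  i<length i = subst (toℕ i <_) (sym (length-walkEdges 0 route)) (i<route i)
  cycle-edge : ∀ (i : Fin n) → edge (toℕ (f (w m (toℕ i)))) (toℕ (f (w m (suc (toℕ i))))) ≡ nth (0 , 0) (walkEdges 0 route) (toℕ i)
  cycle-edge i = trans (cong₂ edge (f-w (<⇒≤ (toℕ<n i))) (f-w (toℕ<n i))) (sym (nth-walkEdges 0 route (i<route i)))
  chord-edge : edge (toℕ (f (w m 0))) (toℕ (f (w m j))) ≡ (0 , 1)
  chord-edge = cong₂ edge (f-w z≤n) (trans (f-w (<⇒≤ j<n)) reaches-1)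
  uses-01 : ∀ i → ¬ SameEdge (f (w m (toℕ i)) , f (w m (suc (toℕ i)))) (f (w m 0) , f (w m j))
  uses-01 i same = All-nth avoids-01 (i<length i) (trans (sym (cycle-edge i)) (trans (SameEdge⇒edge≡ same) chord-edge))
  image : Graph.Edge (C n j) → Fin k × Fin k
  image e = f (proj₁ (Graph.ends (C n j) e)) , f (proj₂ (Graph.ends (C n j) e))
  injective : ∀ e e′ → SameEdge (image e) (image e′) → e ≡ e′
  injective (inj₁ i) (inj₁ i′) same = cong inj₁ (toℕ-injective (nth-injective distinct (i<length i) (i<length i′)
    (trans (sym (cycle-edge i)) (trans (SameEdge⇒edge≡ same) (cycle-edge i′)))))
  injective (inj₁ i)  (inj₂ tt) same = contradiction same (uses-01 i)
  injective (inj₂ tt) (inj₁ i)  same = contradiction (SameEdge-sym same) (uses-01 i)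
  injective (inj₂ tt) (inj₂ tt) _    = refl

first≢ : ∀ {a b c d : ℕ} → a ≢ c → (a , b) ≢ (c , d)
first≢ a≢c = a≢c ∘ ,-injectiveˡ

second≢ : ∀ {a b c d : ℕ} → b ≢ d → (a , b) ≢ (c , d)
second≢ b≢d = b≢d ∘ ,-injectiveʳ

All≢⇒Disjoint : ∀ {A : Set} {xs ys : List A} → All (λ p → All (p ≢_) ys) xs → Disjoint xs ys
All≢⇒Disjoint apart (v∈xs , v∈ys) = All.lookup (All.lookup apart v∈xs) v∈ys refl

All-separated⇒Disjoint : ∀ {A : Set} {P Q : A → Set} {xs ys} → All P xs → All Q ys → (∀ {v} → P v → ¬ Q v) →
  Disjoint xs ys
All-separated⇒Disjoint p-xs q-ys apart (v∈xs , v∈ys) = apart (All.lookup p-xs v∈xs) (All.lookup q-ys v∈ys)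

n≢1+n : ∀ {n} → n ≢ suc n
n≢1+n = <⇒≢ (n<1+n _)

room-step : ∀ i s {x} → i + 2 * suc s ≤ x → 2 + i + 2 * s ≤ x
room-step i s {x} = subst (_≤ x) (trans (cong (i +_) (*-suc 2 s)) (trans (sym (+-assoc i 2 (2 * s))) (cong (_+ 2 * s) (+-comm i 2))))

room-head : ∀ i s {x} → i + 2 * suc s ≤ x → suc i < x
room-head i s room = ≤-trans (m≤m+n (2 + i) (2 * s)) (room-step i s room)

zigzag : ℕ → ℕ → ℕ → List ℕ
zigzag x i zero    = []
zigzag x i (suc s) = i ∷ suc x ∷ suc i ∷ x ∷ zigzag x (2 + i) s

zigzagEdges : ℕ → ℕ → ℕ → List (ℕ × ℕ)
zigzagEdges x i zero    = (0 , x) ∷ []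
zigzagEdges x i (suc s) = (i , x) ∷ (i , suc x) ∷ (suc i , suc x) ∷ (suc i , x) ∷ zigzagEdges x (2 + i) s

walkEdges-zigzag : ∀ x i s → i + 2 * s ≤ x → walkEdges x (zigzag x i s ++ 0 ∷ []) ≡ zigzagEdges x i s
walkEdges-zigzag x i zero    _    = cong (_∷ []) (edge-≥ z≤n)
walkEdges-zigzag x i (suc s) room =
  cong₂ _∷_ (edge-≥ i≤x) (cong₂ _∷_ (edge-≤ (m≤n⇒m≤1+n i≤x)) (cong₂ _∷_ (edge-≥ (s≤s i≤x))
    (cong₂ _∷_ (edge-≤ 1+i≤x) (walkEdges-zigzag x (2 + i) s room′))))
  where
  room′ : 2 + i + 2 * s ≤ x
  room′ = room-step i s room
  1+i≤x : suc i ≤ x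
  1+i≤x = <⇒≤ (room-head i s room)
  i≤x : i ≤ x
  i≤x = ≤-trans (n≤1+n i) 1+i≤x

zigzagEdges-shape : ∀ x i s → i + 2 * s ≤ x →
  All (λ e → (e ≡ (0 , x) ⊎ i ≤ proj₁ e × proj₁ e < x) × x ≤ proj₂ e) (zigzagEdges x i s)
zigzagEdges-shape x i zero    _    = (inj₁ refl , ≤-refl) ∷ []
zigzagEdges-shape x i (suc s) room =
  (inj₂ (≤-refl , i<x) , ≤-refl) ∷ (inj₂ (≤-refl , i<x) , n≤1+n x) ∷
  (inj₂ (n≤1+n i , 1+i<x) , n≤1+n x) ∷ (inj₂ (n≤1+n i , 1+i<x) , ≤-refl) ∷
  All.map (λ { (inj₁ eq , x≤) → inj₁ eq , x≤ ; (inj₂ (2+i≤ , <x) , x≤) → inj₂ (≤-trans (m≤n+m i 2) 2+i≤ , <x) , x≤ })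
          (zigzagEdges-shape x (2 + i) s room′)
  where
  room′ : 2 + i + 2 * s ≤ x
  room′ = room-step i s room
  1+i<x : suc i < x
  1+i<x = room-head i s room
  i<x : i < x
  i<x = <-trans (n<1+n i) 1+i<x

∉zigzagEdges : ∀ {x i s} p → p ≢ (0 , x) → proj₁ p < i ⊎ x ≤ proj₁ p → i + 2 * s ≤ x →
  All (p ≢_) (zigzagEdges x i s)
∉zigzagEdges {x} {i} {s} p p≢0x outside room = All.map apart (zigzagEdges-shape x i s room)
  where
  apart : ∀ {e} → (e ≡ (0 , x) ⊎ i ≤ proj₁ e × proj₁ e < x) × x ≤ proj₂ e → p ≢ e
  apart (inj₁ refl , _)            = p≢0x
  apart (inj₂ (i≤e₁ , e₁<x) , _) refl = [ (λ p₁<i → <⇒≱ p₁<i i≤e₁) , (λ x≤p₁ → <⇒≱ e₁<x x≤p₁) ]′ outside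

zigzagEdges-unique : ∀ x i s → 1 ≤ i → i + 2 * s ≤ x → Unique (zigzagEdges x i s)
zigzagEdges-unique x i zero    _   _    = [] ∷ []
zigzagEdges-unique x i (suc s) 1≤i room =
  (second≢ n≢1+n ∷ first≢ n≢1+n ∷ first≢ n≢1+n ∷ ∉rest (first≢ i≢0) (<-trans (n<1+n i) (n<1+n (suc i)))) ∷
  (first≢ n≢1+n ∷ first≢ n≢1+n ∷ ∉rest (first≢ i≢0) (<-trans (n<1+n i) (n<1+n (suc i)))) ∷
  (second≢ (≢-sym n≢1+n) ∷ ∉rest (first≢ λ ()) (n<1+n (suc i))) ∷
  ∉rest (first≢ λ ()) (n<1+n (suc i)) ∷
  zigzagEdges-unique x (2 + i) s (s≤s z≤n) room′
  where
  room′ : 2 + i + 2 * s ≤ x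
  room′ = room-step i s room
  i≢0 : i ≢ 0
  i≢0 = ≢-sym (<⇒≢ 1≤i)
  ∉rest : ∀ {p} → p ≢ (0 , x) → proj₁ p < 2 + i → All (p ≢_) (zigzagEdges x (2 + i) s)
  ∉rest p≢0x p₁<2+i = ∉zigzagEdges _ p≢0x (inj₁ p₁<2+i) room′

data Loops : Set where
  noLoop oneLoop twoLoops : Loops

loopCount : Loops → ℕ
loopCount noLoop   = 0
loopCount oneLoop  = 1
loopCount twoLoops = 2

module _ (x : ℕ) where

  private
    y : ℕ
    y = suc x

  -- Leaving 0 towards the fresh vertices; the optional loops at y and x give the detour length modulo 4.
  detourStart : Loops → List ℕ
  detourStart noLoop   = y ∷ 1 ∷ x ∷ []
  detourStart oneLoop  = y ∷ y ∷ 1 ∷ x ∷ []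
  detourStart twoLoops = y ∷ y ∷ 1 ∷ x ∷ x ∷ []

  detourStartEdges : Loops → List (ℕ × ℕ)
  detourStartEdges noLoop   = (0 , y) ∷ (1 , y) ∷ (1 , x) ∷ []
  detourStartEdges oneLoop  = (0 , y) ∷ (y , y) ∷ (1 , y) ∷ (1 , x) ∷ []
  detourStartEdges twoLoops = (0 , y) ∷ (y , y) ∷ (1 , y) ∷ (1 , x) ∷ (x , x) ∷ []

  detour : ℕ → Loops → List ℕ
  detour t r = detourStart r ++ zigzag x 2 t ++ 0 ∷ []

  module _ (2≤x : 2 ≤ x) where

    private
      x≢0 : x ≢ 0
      x≢0 = ≢-sym (<⇒≢ (≤-trans (s≤s z≤n) 2≤x))
      1≢x : 1 ≢ x
      1≢x = <⇒≢ 2≤x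
      y≢1 : y ≢ 1
      y≢1 = x≢0 ∘ suc-injective
      y≢x : y ≢ x
      y≢x = ≢-sym n≢1+n
      loop : ∀ {a} → edge a a ≡ (a , a)
      loop = edge-≤ ≤-refl
      edge-y1 : edge y 1 ≡ (1 , y)
      edge-y1 = edge-≥ (s≤s z≤n)
      edge-1x : edge 1 x ≡ (1 , x)
      edge-1x = edge-≤ (≤-trans (s≤s z≤n) 2≤x)
      Outside : ℕ × ℕ → Set
      Outside p = p ≢ (0 , x) × (proj₁ p < 2 ⊎ x ≤ proj₁ p) × x ≤ proj₂ p
      0y : Outside (0 , y)
      0y = second≢ y≢x , inj₁ (s≤s z≤n) , n≤1+n x
      yy : Outside (y , y)
      yy = first≢ (λ ()) , inj₂ (n≤1+n x) , n≤1+n x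
      1y : Outside (1 , y)
      1y = first≢ (λ ()) , inj₁ (s≤s (s≤s z≤n)) , n≤1+n x
      1x : Outside (1 , x)
      1x = first≢ (λ ()) , inj₁ (s≤s (s≤s z≤n)) , ≤-refl
      xx : Outside (x , x)
      xx = first≢ x≢0 , inj₂ ≤-refl , ≤-refl

    walkEdges-detourStart : ∀ r zs → walkEdges 0 (detourStart r ++ zs) ≡ detourStartEdges r ++ walkEdges x zs
    walkEdges-detourStart noLoop   zs = cong₂ _∷_ refl (cong₂ _∷_ edge-y1 (cong₂ _∷_ edge-1x refl))
    walkEdges-detourStart oneLoop  zs = cong₂ _∷_ refl (cong₂ _∷_ loop (cong₂ _∷_ edge-y1 (cong₂ _∷_ edge-1x refl)))
    walkEdges-detourStart twoLoops zs = cong₂ _∷_ refl (cong₂ _∷_ loop (cong₂ _∷_ edge-y1 (cong₂ _∷_ edge-1x (cong₂ _∷_ loop refl))))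

    detourStartEdges-unique : ∀ r → Unique (detourStartEdges r)
    detourStartEdges-unique noLoop =
      (first≢ (λ ()) ∷ first≢ (λ ()) ∷ []) ∷ (second≢ y≢x ∷ []) ∷ [] ∷ []
    detourStartEdges-unique oneLoop =
      (first≢ (λ ()) ∷ first≢ (λ ()) ∷ first≢ (λ ()) ∷ []) ∷ (first≢ y≢1 ∷ first≢ y≢1 ∷ []) ∷ (second≢ y≢x ∷ []) ∷ [] ∷ []
    detourStartEdges-unique twoLoops =
      (first≢ (λ ()) ∷ first≢ (λ ()) ∷ first≢ (λ ()) ∷ first≢ (≢-sym x≢0) ∷ []) ∷
      (first≢ y≢1 ∷ first≢ y≢1 ∷ first≢ y≢x ∷ []) ∷ (second≢ y≢x ∷ first≢ 1≢x ∷ []) ∷ (first≢ 1≢x ∷ []) ∷ [] ∷ []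

    detourStartEdges-outside : ∀ r → All Outside (detourStartEdges r)
    detourStartEdges-outside noLoop   = 0y ∷ 1y ∷ 1x ∷ []
    detourStartEdges-outside oneLoop  = 0y ∷ yy ∷ 1y ∷ 1x ∷ []
    detourStartEdges-outside twoLoops = 0y ∷ yy ∷ 1y ∷ 1x ∷ xx ∷ []

    module _ (t : ℕ) (room : 2 + 2 * t ≤ x) where

      walkEdges-detour : ∀ r → walkEdges 0 (detour t r) ≡ detourStartEdges r ++ zigzagEdges x 2 t
      walkEdges-detour r = trans (walkEdges-detourStart r _) (cong (detourStartEdges r ++_) (walkEdges-zigzag x 2 t room))

      detour-distinct : ∀ r → Unique (walkEdges 0 (detour t r))
      detour-distinct r = subst Unique (sym (walkEdges-detour r))
        (++⁺ (detourStartEdges-unique r) (zigzagEdges-unique x 2 t (s≤s z≤n) room)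
             (All≢⇒Disjoint (All.map (λ (p≢0x , outside , _) → ∉zigzagEdges _ p≢0x outside room) (detourStartEdges-outside r))))

      detour-new : ∀ r → All (λ e → x ≤ proj₂ e) (walkEdges 0 (detour t r))
      detour-new r = subst (All (λ e → x ≤ proj₂ e)) (sym (walkEdges-detour r))
        (All.++⁺ (All.map (proj₂ ∘ proj₂) (detourStartEdges-outside r)) (All.map proj₂ (zigzagEdges-shape x 2 t room)))

      detour-avoids-01 : ∀ r → All (_≢ (0 , 1)) (walkEdges 0 (detour t r))
      detour-avoids-01 r = All.map (λ x≤e₂ e≡01 → <⇒≱ 2≤x (subst (λ e → x ≤ proj₂ e) e≡01 x≤e₂)) (detour-new r)

      detour-bounded : ∀ r → All (_< 2 + x) (detour t r)
      detour-bounded r = All.++⁺ (start r) (All.++⁺ (zigzag-bounded 2 t room) (s≤s z≤n ∷ []))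
        where
        x<2+x : x < 2 + x
        x<2+x = m<n+m x (s≤s z≤n)
        start : ∀ r → All (_< 2 + x) (detourStart r)
        start noLoop   = ≤-refl ∷ s≤s (s≤s z≤n) ∷ x<2+x ∷ []
        start oneLoop  = ≤-refl ∷ ≤-refl ∷ s≤s (s≤s z≤n) ∷ x<2+x ∷ []
        start twoLoops = ≤-refl ∷ ≤-refl ∷ s≤s (s≤s z≤n) ∷ x<2+x ∷ x<2+x ∷ []
        zigzag-bounded : ∀ i s → i + 2 * s ≤ x → All (_< 2 + x) (zigzag x i s)
        zigzag-bounded i zero    _     = []
        zigzag-bounded i (suc s) room′ =
          s≤s (m≤n⇒m≤1+n (<⇒≤ (<-trans (n<1+n i) 1+i<x))) ∷ ≤-refl ∷ s≤s (m≤n⇒m≤1+n (<⇒≤ 1+i<x)) ∷ x<2+x ∷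
          zigzag-bounded (2 + i) s (room-step i s room′)
          where
          1+i<x : suc i < x
          1+i<x = room-head i s room′

endpoint-detour : ∀ x t r a → endpoint a (detour x t r) ≡ 0
endpoint-detour x t r a = trans (endpoint-++ a (detourStart x r) _) (endpoint-++ _ (zigzag x 2 t) (0 ∷ []))

length-zigzag : ∀ x i s → length (zigzag x i s) ≡ 4 * s
length-zigzag x i zero    = refl
length-zigzag x i (suc s) = trans (cong (4 +_) (length-zigzag x (2 + i) s)) (sym (*-suc 4 s))

length-detour : ∀ x t r → length (detour x t r) ≡ 4 * suc t + loopCount r
length-detour x t r = begin
  length (detour x t r)                                      ≡⟨ length-++ (detourStart x r) ⟩
  length (detourStart x r) + length (zigzag x 2 t ++ 0 ∷ []) ≡⟨ cong₂ _+_ (start r) (length-++ (zigzag x 2 t)) ⟩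
  (3 + loopCount r) + (length (zigzag x 2 t) + 1)            ≡⟨ cong (λ z → (3 + loopCount r) + (z + 1)) (length-zigzag x 2 t) ⟩
  (3 + loopCount r) + (4 * t + 1)                            ≡⟨ arith (loopCount r) t ⟩
  4 * suc t + loopCount r                                    ∎
  where
  open ≡-Reasoning
  start : ∀ r → length (detourStart x r) ≡ 3 + loopCount r
  start noLoop   = refl
  start oneLoop  = refl
  start twoLoops = refl
  arith : ∀ r t → (3 + r) + (4 * t + 1) ≡ 4 * suc t + r
  arith = solve-∀

module _ {x t : ℕ} (r : Loops) (2≤x : 2 ≤ x) (room : 2 + 2 * t ≤ x) where

  private
    D : List ℕ
    D = detour x t r

    x≤2+x : x ≤ 2 + x
    x≤2+x = m≤n+m x 2

    old-new-disjoint : ∀ {route} → All (_< x) route → Disjoint (walkEdges 0 route) (walkEdges 0 D)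
    old-new-disjoint route<x = All-separated⇒Disjoint (walkEdges-below (≤-trans (s≤s z≤n) 2≤x) route<x)
      (detour-new x 2≤x t room r) <⇒≱

  appendDetour : ∀ {n j} → j ≤ n → ClosedTrail x n j → ClosedTrail (2 + x) (n + length D) j
  appendDetour {n} {j} j≤n T = record
    { route     = route ++ D
    ; length≡n  = trans (length-++ route) (cong (_+ length D) length≡n)
    ; returns   = trans (endpoint-++ 0 route D) (endpoint-detour x t r _)
    ; bounded   = All.++⁺ (All.map (λ v<x → ≤-trans v<x x≤2+x) bounded) (detour-bounded x 2≤x t room r)
    ; distinct  = subst Unique (sym edges) (++⁺ distinct (detour-distinct x 2≤x t room r) (old-new-disjoint bounded))
    ; avoids-01 = subst (All (_≢ (0 , 1))) (sym edges) (All.++⁺ avoids-01 (detour-avoids-01 x 2≤x t room r))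
    ; reaches-1 = trans (nth-++ˡ 0 route D (subst (j ≤_) (sym length≡n) j≤n)) reaches-1
    }
    where
    open ClosedTrail T
    edges : walkEdges 0 (route ++ D) ≡ walkEdges 0 route ++ walkEdges 0 D
    edges = trans (walkEdges-++ 0 route D) (cong (λ a → walkEdges 0 route ++ walkEdges a D) returns)

  prependDetour : ∀ {n j} → ClosedTrail x n j → ClosedTrail (2 + x) (length D + n) (length D + j)
  prependDetour {n} {j} T = record
    { route     = D ++ route
    ; length≡n  = trans (length-++ D) (cong (length D +_) length≡n)
    ; returns   = trans (endpoint-++ 0 D route) (trans (cong (λ a → endpoint a route) (endpoint-detour x t r 0)) returns)
    ; bounded   = All.++⁺ (detour-bounded x 2≤x t room r) (All.map (λ v<x → ≤-trans v<x x≤2+x) bounded)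
    ; distinct  = subst Unique (sym edges) (++⁺ (detour-distinct x 2≤x t room r) distinct (Disjoint.sym (old-new-disjoint bounded)))
    ; avoids-01 = subst (All (_≢ (0 , 1))) (sym edges) (All.++⁺ (detour-avoids-01 x 2≤x t room r) avoids-01)
    ; reaches-1 = trans (nth-++ʳ 0 D route j) (trans (cong (λ a → nth 0 (a ∷ route) j) (endpoint-detour x t r 0)) reaches-1)
    }
    where
    open ClosedTrail T
    edges : walkEdges 0 (D ++ route) ≡ walkEdges 0 D ++ walkEdges 0 route
    edges = trans (walkEdges-++ 0 D route) (cong (λ a → walkEdges 0 D ++ walkEdges a route) (endpoint-detour x t r 0))

capacity : ℕ → ℕ
capacity m = 2 * (m * m)

capacity-suc : ∀ m → capacity (suc m) ≡ capacity m + (4 * m + 2)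
capacity-suc = identity
  where
  identity : ∀ m → 2 * (suc m * suc m) ≡ 2 * (m * m) + (4 * m + 2)
  identity = solve-∀

capacity-double : ∀ q → (q * 2) * (q * 2) ≡ 2 * capacity q
capacity-double = identity
  where
  identity : ∀ q → (q * 2) * (q * 2) ≡ 2 * (2 * (q * q))
  identity = solve-∀

-- Lengths 4t + r with r ≤ 2, i.e. not ≡ 3 modulo 4; split e is the least such length ≥ e.
split : ℕ → ℕ × Loops
split 0                         = 0 , noLoop
split 1                         = 0 , oneLoop
split 2                         = 0 , twoLoops
split 3                         = 1 , noLoop
split (suc (suc (suc (suc e)))) = map₁ suc (split e)

splitValue : ℕ → ℕ
splitValue e = 4 * proj₁ (split e) + loopCount (proj₂ (split e))

splitValue-+4 : ∀ e → splitValue (4 + e) ≡ 4 + splitValue e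
splitValue-+4 e = trans (cong (_+ loopCount (proj₂ (split e))) (*-suc 4 (proj₁ (split e)))) (+-assoc 4 (4 * proj₁ (split e)) _)

splitValue-≥ : ∀ e → e ≤ splitValue e
splitValue-≥ 0                         = z≤n
splitValue-≥ 1                         = s≤s z≤n
splitValue-≥ 2                         = s≤s (s≤s z≤n)
splitValue-≥ 3                         = s≤s (s≤s (s≤s z≤n))
splitValue-≥ (suc (suc (suc (suc e)))) = subst (4 + e ≤_) (sym (splitValue-+4 e)) (+-monoʳ-≤ 4 (splitValue-≥ e))

splitValue-≤ : ∀ e → splitValue e ≤ suc e
splitValue-≤ 0                         = z≤n
splitValue-≤ 1                         = s≤s z≤n
splitValue-≤ 2                         = s≤s (s≤s z≤n)
splitValue-≤ 3                         = s≤s (s≤s (s≤s (s≤s z≤n)))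
splitValue-≤ (suc (suc (suc (suc e)))) = subst (_≤ 5 + e) (sym (splitValue-+4 e)) (+-monoʳ-≤ 4 (splitValue-≤ e))

-- The detour lengthening a trail in K_{2m}^* to length n; every detour has at least four steps.
detourShape : ℕ → ℕ → ℕ × Loops
detourShape m n = split (n ∸ capacity m ∸ 4)

detourLength : ℕ → ℕ → ℕ
detourLength m n = 4 * suc (proj₁ (detourShape m n)) + loopCount (proj₂ (detourShape m n))

detourLength≡ : ∀ m n → detourLength m n ≡ 4 + splitValue (n ∸ capacity m ∸ 4)
detourLength≡ m n = trans (cong (_+ loopCount (proj₂ (detourShape m n))) (*-suc 4 (proj₁ (detourShape m n))))
  (+-assoc 4 (4 * proj₁ (detourShape m n)) (loopCount (proj₂ (detourShape m n))))

excess≤detourLength : ∀ m n → n ∸ capacity m ≤ detourLength m n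
excess≤detourLength m n = begin
  n ∸ capacity m                      ≤⟨ m≤n+m∸n (n ∸ capacity m) 4 ⟩
  4 + (n ∸ capacity m ∸ 4)            ≤⟨ +-monoʳ-≤ 4 (splitValue-≥ _) ⟩
  4 + splitValue (n ∸ capacity m ∸ 4) ≡⟨ detourLength≡ m n ⟨
  detourLength m n                    ∎
  where open ≤-Reasoning

detourLength≤ : ∀ m n → detourLength m n ≤ 5 + (n ∸ capacity m ∸ 4)
detourLength≤ m n = begin
  detourLength m n                    ≡⟨ detourLength≡ m n ⟩
  4 + splitValue (n ∸ capacity m ∸ 4) ≤⟨ +-monoʳ-≤ 4 (splitValue-≤ _) ⟩
  5 + (n ∸ capacity m ∸ 4)            ∎
  where open ≤-Reasoning

excess≤ : ∀ m n → n ≤ capacity (suc m) → n ∸ capacity m ≤ 4 * m + 2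
excess≤ m n n≤ = m≤n+o⇒m∸n≤o n (capacity m) (subst (n ≤_) (capacity-suc m) n≤)

shortened-fits : ∀ m n → n ∸ detourLength m n ≤ capacity m
shortened-fits m n = m≤n+o⇒m∸n≤o n (detourLength m n)
  (≤-trans (m≤n+m∸n n (capacity m)) (≤-trans (+-monoʳ-≤ (capacity m) (excess≤detourLength m n)) (≤-reflexive (+-comm (capacity m) _))))

detour-room : ∀ m n → 1 ≤ m → n ≤ capacity (suc m) → 2 + 2 * proj₁ (detourShape m n) ≤ 2 * m
detour-room (suc m′) n _ n≤ = subst (_≤ 2 * m) (*-suc 2 t) (*-monoʳ-≤ 2 (s≤s⁻¹ (*-cancelˡ-< 4 (suc t) (suc m) (begin-strict
  4 * suc t                  ≤⟨ m≤m+n (4 * suc t) _ ⟩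
  detourLength m n           ≤⟨ detourLength≤ m n ⟩
  5 + (n ∸ capacity m ∸ 4)   ≤⟨ +-monoʳ-≤ 5 (∸-monoˡ-≤ 4 (excess≤ m n n≤)) ⟩
  5 + (4 * m + 2 ∸ 4)        ≡⟨ cong (λ z → 5 + (z ∸ 4)) (arith₁ m′) ⟩
  5 + (4 + (4 * m′ + 2) ∸ 4) ≡⟨ cong (5 +_) (m+n∸m≡n 4 (4 * m′ + 2)) ⟩
  5 + (4 * m′ + 2)           <⟨ arith₂ m′ ⟩
  4 * suc m                  ∎))))
  where
  open ≤-Reasoning
  m : ℕ
  m = suc m′
  t : ℕ
  t = proj₁ (detourShape m n)
  arith₁ : ∀ m′ → 4 * suc m′ + 2 ≡ 4 + (4 * m′ + 2)
  arith₁ = solve-∀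
  arith₂ : ∀ m′ → 5 + (4 * m′ + 2) < 4 * suc (suc m′)
  arith₂ m′ = ≤-reflexive (eq m′)
    where
    eq : ∀ m′ → suc (5 + (4 * m′ + 2)) ≡ 4 * suc (suc m′)
    eq = solve-∀

far-chord-prependable : ∀ m n j → 6 ≤ m → capacity m < n → n ≤ capacity (suc m) →
  ¬ (2 * j ≤ n ∸ detourLength m n) → detourLength m n + 2 ≤ j
far-chord-prependable m n j 6≤m cap<n n≤ too-far = ≮⇒≥ λ j<d+2 → <-irrefl refl (<-trans (small j<d+2) large)
  where
  open ≤-Reasoning
  u : ℕ
  u = n ∸ capacity m
  d : ℕ
  d = detourLength m n
  d≤u+5 : d ≤ u + 5
  d≤u+5 = begin
    d           ≤⟨ detourLength≤ m n ⟩
    5 + (u ∸ 4) ≤⟨ +-monoʳ-≤ 5 (m∸n≤m u 4) ⟩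
    5 + u       ≡⟨ +-comm 5 u ⟩
    u + 5       ∎
  small : j < d + 2 → capacity m < 8 * m + 21
  small j<d+2 = begin-strict
    capacity m           <⟨ +-cancelʳ-< u (capacity m) (2 * u + 17) (begin-strict
      capacity m + u  ≡⟨ m+[n∸m]≡n (<⇒≤ cap<n) ⟩
      n               ≤⟨ m≤n+m∸n n d ⟩
      d + (n ∸ d)     <⟨ +-monoʳ-< d (≰⇒> too-far) ⟩
      d + 2 * j       ≤⟨ +-monoʳ-≤ d (*-monoʳ-≤ 2 j≤d+1) ⟩
      d + 2 * (d + 1) ≡⟨ arith₁ d ⟩
      3 * d + 2       ≤⟨ +-monoˡ-≤ 2 (*-monoʳ-≤ 3 d≤u+5) ⟩
      3 * (u + 5) + 2 ≡⟨ arith₂ u ⟩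
      2 * u + 17 + u  ∎) ⟩
    2 * u + 17           ≤⟨ +-monoˡ-≤ 17 (*-monoʳ-≤ 2 (excess≤ m n n≤)) ⟩
    2 * (4 * m + 2) + 17 ≡⟨ arith₃ m ⟩
    8 * m + 21           ∎
    where
    j≤d+1 : j ≤ d + 1
    j≤d+1 = s≤s⁻¹ (subst (suc j ≤_) (+-suc d 1) j<d+2)
    arith₁ : ∀ d → d + 2 * (d + 1) ≡ 3 * d + 2
    arith₁ = solve-∀
    arith₂ : ∀ u → 3 * (u + 5) + 2 ≡ 2 * u + 17 + u
    arith₂ = solve-∀
    arith₃ : ∀ m → 2 * (4 * m + 2) + 17 ≡ 8 * m + 21
    arith₃ = solve-∀
  large : 8 * m + 21 < capacity m
  large = begin-strict
    8 * m + 21    <⟨ +-monoʳ-< (8 * m) (n<1+n 21) ⟩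
    8 * m + 22    ≤⟨ +-monoʳ-≤ (8 * m) (≤-trans (m≤m+n 22 2) (*-monoʳ-≤ 4 6≤m)) ⟩
    8 * m + 4 * m ≡⟨ arith m ⟩
    2 * (6 * m)   ≤⟨ *-monoʳ-≤ 2 (*-monoˡ-≤ m 6≤m) ⟩
    capacity m    ∎
    where
    arith : ∀ m → 8 * m + 4 * m ≡ 2 * (6 * m)
    arith = solve-∀

IsClosedTrail : ℕ → ℕ → ℕ → List ℕ → Set
IsClosedTrail k n j route =
  length route ≡ n × endpoint 0 route ≡ 0 × All (_< k) route × Unique (walkEdges 0 route) ×
  All (_≢ (0 , 1)) (walkEdges 0 route) × nth 0 (0 ∷ route) j ≡ 1

isClosedTrail? : ∀ k n j route → Dec (IsClosedTrail k n j route)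
isClosedTrail? k n j route =
  length route ≟ n ×-dec endpoint 0 route ≟ 0 ×-dec all? (_<? k) route ×-dec DecUnique.unique? _≟ₑ_ (walkEdges 0 route) ×-dec
  all? (λ e → ¬? (e ≟ₑ (0 , 1))) (walkEdges 0 route) ×-dec nth 0 (0 ∷ route) j ≟ 1

IsClosedTrail⇒ClosedTrail : ∀ {k n j route} → IsClosedTrail k n j route → ClosedTrail k n j
IsClosedTrail⇒ClosedTrail {route = route} (l , e , b , d , a , r) = record
  { route = route ; length≡n = l ; returns = e ; bounded = b ; distinct = d ; avoids-01 = a ; reaches-1 = r }

-- Closed trails found by computer search, as (k / 2 , n , j , route).
knownTrails : List (ℕ × ℕ × ℕ × List ℕ)
knownTrails =
  (2 , 4 , 2 , (2 ∷ 1 ∷ 3 ∷ 0 ∷ [])) ∷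
  (2 , 5 , 2 , (2 ∷ 1 ∷ 1 ∷ 3 ∷ 0 ∷ [])) ∷
  (2 , 6 , 2 , (2 ∷ 1 ∷ 1 ∷ 3 ∷ 0 ∷ 0 ∷ [])) ∷
  (2 , 6 , 3 , (2 ∷ 1 ∷ 1 ∷ 3 ∷ 0 ∷ 0 ∷ [])) ∷
  (2 , 7 , 2 , (2 ∷ 1 ∷ 1 ∷ 3 ∷ 3 ∷ 0 ∷ 0 ∷ [])) ∷
  (2 , 7 , 3 , (2 ∷ 1 ∷ 1 ∷ 3 ∷ 3 ∷ 0 ∷ 0 ∷ [])) ∷
  (2 , 8 , 3 , (2 ∷ 2 ∷ 1 ∷ 1 ∷ 3 ∷ 3 ∷ 0 ∷ 0 ∷ [])) ∷
  (2 , 8 , 4 , (2 ∷ 2 ∷ 1 ∷ 1 ∷ 3 ∷ 3 ∷ 0 ∷ 0 ∷ [])) ∷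
  (3 , 9 , 3 , (4 ∷ 4 ∷ 1 ∷ 5 ∷ 5 ∷ 3 ∷ 1 ∷ 2 ∷ 0 ∷ [])) ∷
  (3 , 9 , 4 , (4 ∷ 4 ∷ 5 ∷ 1 ∷ 3 ∷ 3 ∷ 4 ∷ 2 ∷ 0 ∷ [])) ∷
  (3 , 10 , 4 , (4 ∷ 4 ∷ 5 ∷ 1 ∷ 3 ∷ 3 ∷ 0 ∷ 2 ∷ 5 ∷ 0 ∷ [])) ∷
  (3 , 10 , 5 , (4 ∷ 4 ∷ 5 ∷ 5 ∷ 1 ∷ 3 ∷ 0 ∷ 2 ∷ 5 ∷ 0 ∷ [])) ∷
  (3 , 11 , 4 , (4 ∷ 4 ∷ 5 ∷ 1 ∷ 3 ∷ 3 ∷ 0 ∷ 0 ∷ 2 ∷ 5 ∷ 0 ∷ [])) ∷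
  (3 , 11 , 5 , (4 ∷ 4 ∷ 5 ∷ 5 ∷ 1 ∷ 3 ∷ 0 ∷ 0 ∷ 2 ∷ 5 ∷ 0 ∷ [])) ∷
  (3 , 12 , 2 , (4 ∷ 1 ∷ 1 ∷ 5 ∷ 5 ∷ 3 ∷ 1 ∷ 2 ∷ 2 ∷ 4 ∷ 3 ∷ 0 ∷ [])) ∷
  (3 , 12 , 5 , (4 ∷ 4 ∷ 5 ∷ 5 ∷ 1 ∷ 3 ∷ 0 ∷ 0 ∷ 2 ∷ 2 ∷ 5 ∷ 0 ∷ [])) ∷
  (3 , 12 , 6 , (4 ∷ 4 ∷ 5 ∷ 5 ∷ 3 ∷ 1 ∷ 1 ∷ 2 ∷ 2 ∷ 4 ∷ 3 ∷ 0 ∷ [])) ∷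
  (3 , 13 , 2 , (4 ∷ 1 ∷ 1 ∷ 5 ∷ 5 ∷ 3 ∷ 1 ∷ 2 ∷ 2 ∷ 4 ∷ 4 ∷ 3 ∷ 0 ∷ [])) ∷
  (3 , 13 , 5 , (4 ∷ 4 ∷ 5 ∷ 5 ∷ 1 ∷ 3 ∷ 0 ∷ 0 ∷ 2 ∷ 2 ∷ 3 ∷ 5 ∷ 0 ∷ [])) ∷
  (3 , 13 , 6 , (4 ∷ 4 ∷ 5 ∷ 5 ∷ 3 ∷ 1 ∷ 1 ∷ 2 ∷ 2 ∷ 4 ∷ 1 ∷ 5 ∷ 0 ∷ [])) ∷
  (3 , 14 , 2 , (4 ∷ 1 ∷ 1 ∷ 5 ∷ 5 ∷ 3 ∷ 1 ∷ 2 ∷ 2 ∷ 4 ∷ 4 ∷ 3 ∷ 0 ∷ 0 ∷ [])) ∷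
  (3 , 14 , 5 , (4 ∷ 4 ∷ 5 ∷ 5 ∷ 1 ∷ 3 ∷ 0 ∷ 0 ∷ 2 ∷ 2 ∷ 4 ∷ 3 ∷ 5 ∷ 0 ∷ [])) ∷
  (3 , 14 , 6 , (4 ∷ 4 ∷ 5 ∷ 5 ∷ 3 ∷ 1 ∷ 1 ∷ 2 ∷ 2 ∷ 4 ∷ 1 ∷ 5 ∷ 0 ∷ 0 ∷ [])) ∷
  (3 , 14 , 7 , (4 ∷ 4 ∷ 5 ∷ 5 ∷ 3 ∷ 1 ∷ 1 ∷ 2 ∷ 2 ∷ 4 ∷ 1 ∷ 5 ∷ 0 ∷ 0 ∷ [])) ∷
  (3 , 15 , 4 , (4 ∷ 4 ∷ 5 ∷ 1 ∷ 3 ∷ 3 ∷ 0 ∷ 0 ∷ 2 ∷ 2 ∷ 1 ∷ 4 ∷ 3 ∷ 5 ∷ 0 ∷ [])) ∷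
  (3 , 15 , 5 , (4 ∷ 4 ∷ 5 ∷ 5 ∷ 1 ∷ 3 ∷ 0 ∷ 0 ∷ 2 ∷ 2 ∷ 1 ∷ 4 ∷ 3 ∷ 5 ∷ 0 ∷ [])) ∷
  (3 , 15 , 6 , (4 ∷ 4 ∷ 5 ∷ 5 ∷ 3 ∷ 1 ∷ 1 ∷ 2 ∷ 2 ∷ 4 ∷ 1 ∷ 5 ∷ 2 ∷ 3 ∷ 0 ∷ [])) ∷
  (3 , 15 , 7 , (4 ∷ 4 ∷ 5 ∷ 5 ∷ 3 ∷ 1 ∷ 1 ∷ 2 ∷ 2 ∷ 4 ∷ 1 ∷ 5 ∷ 2 ∷ 3 ∷ 0 ∷ [])) ∷
  (3 , 16 , 2 , (4 ∷ 1 ∷ 1 ∷ 5 ∷ 5 ∷ 3 ∷ 1 ∷ 2 ∷ 2 ∷ 4 ∷ 4 ∷ 3 ∷ 0 ∷ 5 ∷ 2 ∷ 0 ∷ [])) ∷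
  (3 , 16 , 5 , (4 ∷ 4 ∷ 5 ∷ 5 ∷ 1 ∷ 3 ∷ 0 ∷ 0 ∷ 2 ∷ 2 ∷ 1 ∷ 4 ∷ 3 ∷ 3 ∷ 5 ∷ 0 ∷ [])) ∷
  (3 , 16 , 6 , (4 ∷ 4 ∷ 5 ∷ 5 ∷ 3 ∷ 1 ∷ 1 ∷ 2 ∷ 2 ∷ 4 ∷ 1 ∷ 5 ∷ 0 ∷ 3 ∷ 2 ∷ 0 ∷ [])) ∷
  (3 , 16 , 7 , (4 ∷ 4 ∷ 5 ∷ 5 ∷ 3 ∷ 1 ∷ 1 ∷ 2 ∷ 2 ∷ 4 ∷ 1 ∷ 5 ∷ 0 ∷ 3 ∷ 2 ∷ 0 ∷ [])) ∷
  (3 , 16 , 8 , (4 ∷ 4 ∷ 5 ∷ 5 ∷ 3 ∷ 0 ∷ 2 ∷ 1 ∷ 4 ∷ 3 ∷ 3 ∷ 1 ∷ 1 ∷ 5 ∷ 0 ∷ 0 ∷ [])) ∷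
  (3 , 17 , 2 , (4 ∷ 1 ∷ 1 ∷ 5 ∷ 5 ∷ 3 ∷ 1 ∷ 2 ∷ 2 ∷ 4 ∷ 4 ∷ 3 ∷ 0 ∷ 5 ∷ 2 ∷ 0 ∷ 0 ∷ [])) ∷
  (3 , 17 , 5 , (4 ∷ 4 ∷ 5 ∷ 5 ∷ 1 ∷ 3 ∷ 0 ∷ 0 ∷ 2 ∷ 2 ∷ 1 ∷ 4 ∷ 3 ∷ 3 ∷ 2 ∷ 5 ∷ 0 ∷ [])) ∷
  (3 , 17 , 6 , (4 ∷ 4 ∷ 5 ∷ 5 ∷ 3 ∷ 1 ∷ 1 ∷ 2 ∷ 2 ∷ 4 ∷ 1 ∷ 5 ∷ 0 ∷ 3 ∷ 3 ∷ 2 ∷ 0 ∷ [])) ∷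
  (3 , 17 , 7 , (4 ∷ 4 ∷ 5 ∷ 5 ∷ 3 ∷ 1 ∷ 1 ∷ 2 ∷ 2 ∷ 4 ∷ 1 ∷ 5 ∷ 0 ∷ 3 ∷ 3 ∷ 2 ∷ 0 ∷ [])) ∷
  (3 , 17 , 8 , (4 ∷ 4 ∷ 5 ∷ 5 ∷ 3 ∷ 0 ∷ 2 ∷ 1 ∷ 4 ∷ 2 ∷ 2 ∷ 3 ∷ 3 ∷ 1 ∷ 1 ∷ 5 ∷ 0 ∷ [])) ∷
  (3 , 18 , 2 , (4 ∷ 1 ∷ 1 ∷ 5 ∷ 5 ∷ 3 ∷ 1 ∷ 2 ∷ 2 ∷ 4 ∷ 4 ∷ 3 ∷ 3 ∷ 0 ∷ 5 ∷ 2 ∷ 0 ∷ 0 ∷ [])) ∷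
  (3 , 18 , 5 , (4 ∷ 4 ∷ 5 ∷ 5 ∷ 1 ∷ 3 ∷ 0 ∷ 0 ∷ 2 ∷ 2 ∷ 1 ∷ 1 ∷ 4 ∷ 2 ∷ 3 ∷ 3 ∷ 5 ∷ 0 ∷ [])) ∷
  (3 , 18 , 6 , (4 ∷ 4 ∷ 5 ∷ 5 ∷ 3 ∷ 1 ∷ 1 ∷ 2 ∷ 2 ∷ 4 ∷ 1 ∷ 5 ∷ 0 ∷ 3 ∷ 3 ∷ 2 ∷ 0 ∷ 0 ∷ [])) ∷
  (3 , 18 , 7 , (4 ∷ 4 ∷ 5 ∷ 5 ∷ 3 ∷ 1 ∷ 1 ∷ 2 ∷ 2 ∷ 4 ∷ 1 ∷ 5 ∷ 0 ∷ 3 ∷ 3 ∷ 2 ∷ 0 ∷ 0 ∷ [])) ∷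
  (3 , 18 , 8 , (4 ∷ 4 ∷ 5 ∷ 5 ∷ 3 ∷ 0 ∷ 2 ∷ 1 ∷ 4 ∷ 2 ∷ 2 ∷ 3 ∷ 3 ∷ 1 ∷ 1 ∷ 5 ∷ 0 ∷ 0 ∷ [])) ∷
  (3 , 18 , 9 , (4 ∷ 4 ∷ 5 ∷ 5 ∷ 3 ∷ 1 ∷ 2 ∷ 4 ∷ 1 ∷ 1 ∷ 5 ∷ 0 ∷ 3 ∷ 3 ∷ 2 ∷ 2 ∷ 0 ∷ 0 ∷ [])) ∷
  (4 , 25 , 9 , (4 ∷ 1 ∷ 5 ∷ 3 ∷ 0 ∷ 5 ∷ 2 ∷ 3 ∷ 1 ∷ 1 ∷ 6 ∷ 2 ∷ 7 ∷ 3 ∷ 3 ∷ 6 ∷ 7 ∷ 7 ∷ 4 ∷ 4 ∷ 2 ∷ 1 ∷ 7 ∷ 0 ∷ 0 ∷ [])) ∷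
  (4 , 27 , 10 , (4 ∷ 1 ∷ 5 ∷ 3 ∷ 0 ∷ 5 ∷ 2 ∷ 3 ∷ 1 ∷ 1 ∷ 6 ∷ 2 ∷ 7 ∷ 3 ∷ 3 ∷ 6 ∷ 7 ∷ 7 ∷ 4 ∷ 4 ∷ 2 ∷ 1 ∷ 7 ∷ 5 ∷ 4 ∷ 6 ∷ 0 ∷ [])) ∷
  (4 , 28 , 10 , (4 ∷ 1 ∷ 5 ∷ 3 ∷ 0 ∷ 5 ∷ 2 ∷ 3 ∷ 1 ∷ 1 ∷ 6 ∷ 2 ∷ 7 ∷ 3 ∷ 3 ∷ 6 ∷ 7 ∷ 7 ∷ 4 ∷ 4 ∷ 2 ∷ 1 ∷ 7 ∷ 5 ∷ 4 ∷ 6 ∷ 6 ∷ 0 ∷ [])) ∷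
  (4 , 28 , 11 , (4 ∷ 1 ∷ 5 ∷ 3 ∷ 0 ∷ 5 ∷ 2 ∷ 3 ∷ 4 ∷ 6 ∷ 1 ∷ 2 ∷ 7 ∷ 3 ∷ 1 ∷ 1 ∷ 7 ∷ 6 ∷ 0 ∷ 7 ∷ 4 ∷ 4 ∷ 5 ∷ 5 ∷ 6 ∷ 6 ∷ 2 ∷ 0 ∷ [])) ∷
  (4 , 29 , 9 , (4 ∷ 1 ∷ 5 ∷ 3 ∷ 0 ∷ 5 ∷ 2 ∷ 3 ∷ 1 ∷ 1 ∷ 6 ∷ 2 ∷ 7 ∷ 3 ∷ 3 ∷ 6 ∷ 7 ∷ 7 ∷ 4 ∷ 4 ∷ 2 ∷ 1 ∷ 7 ∷ 5 ∷ 4 ∷ 6 ∷ 6 ∷ 0 ∷ 0 ∷ [])) ∷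
  (4 , 29 , 10 , (4 ∷ 1 ∷ 5 ∷ 3 ∷ 0 ∷ 5 ∷ 2 ∷ 3 ∷ 1 ∷ 1 ∷ 6 ∷ 2 ∷ 7 ∷ 3 ∷ 3 ∷ 6 ∷ 7 ∷ 7 ∷ 4 ∷ 4 ∷ 2 ∷ 1 ∷ 7 ∷ 5 ∷ 4 ∷ 6 ∷ 6 ∷ 0 ∷ 0 ∷ [])) ∷
  (4 , 29 , 11 , (4 ∷ 1 ∷ 5 ∷ 3 ∷ 0 ∷ 5 ∷ 2 ∷ 3 ∷ 4 ∷ 6 ∷ 1 ∷ 2 ∷ 7 ∷ 3 ∷ 1 ∷ 1 ∷ 7 ∷ 6 ∷ 0 ∷ 7 ∷ 4 ∷ 4 ∷ 5 ∷ 6 ∷ 6 ∷ 2 ∷ 2 ∷ 0 ∷ 0 ∷ [])) ∷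
  (4 , 29 , 12 , (4 ∷ 1 ∷ 5 ∷ 3 ∷ 0 ∷ 5 ∷ 2 ∷ 3 ∷ 4 ∷ 6 ∷ 2 ∷ 1 ∷ 3 ∷ 3 ∷ 7 ∷ 0 ∷ 6 ∷ 6 ∷ 7 ∷ 4 ∷ 4 ∷ 5 ∷ 5 ∷ 7 ∷ 7 ∷ 2 ∷ 2 ∷ 0 ∷ 0 ∷ [])) ∷
  (4 , 29 , 13 , (4 ∷ 1 ∷ 5 ∷ 3 ∷ 0 ∷ 5 ∷ 2 ∷ 3 ∷ 4 ∷ 6 ∷ 2 ∷ 7 ∷ 1 ∷ 3 ∷ 3 ∷ 6 ∷ 7 ∷ 7 ∷ 4 ∷ 4 ∷ 2 ∷ 1 ∷ 6 ∷ 6 ∷ 5 ∷ 5 ∷ 7 ∷ 0 ∷ 0 ∷ [])) ∷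
  (4 , 30 , 10 , (4 ∷ 1 ∷ 5 ∷ 3 ∷ 0 ∷ 5 ∷ 2 ∷ 3 ∷ 1 ∷ 1 ∷ 6 ∷ 2 ∷ 7 ∷ 3 ∷ 3 ∷ 6 ∷ 7 ∷ 7 ∷ 4 ∷ 4 ∷ 2 ∷ 1 ∷ 7 ∷ 5 ∷ 5 ∷ 4 ∷ 6 ∷ 6 ∷ 0 ∷ 0 ∷ [])) ∷
  (4 , 30 , 11 , (4 ∷ 1 ∷ 5 ∷ 3 ∷ 0 ∷ 5 ∷ 2 ∷ 3 ∷ 4 ∷ 6 ∷ 1 ∷ 2 ∷ 7 ∷ 3 ∷ 1 ∷ 1 ∷ 7 ∷ 6 ∷ 0 ∷ 7 ∷ 4 ∷ 4 ∷ 5 ∷ 5 ∷ 6 ∷ 6 ∷ 2 ∷ 2 ∷ 0 ∷ 0 ∷ [])) ∷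
  (4 , 30 , 12 , (4 ∷ 1 ∷ 5 ∷ 3 ∷ 0 ∷ 5 ∷ 2 ∷ 3 ∷ 4 ∷ 6 ∷ 2 ∷ 1 ∷ 3 ∷ 3 ∷ 7 ∷ 0 ∷ 6 ∷ 6 ∷ 7 ∷ 4 ∷ 4 ∷ 5 ∷ 6 ∷ 1 ∷ 7 ∷ 7 ∷ 2 ∷ 2 ∷ 0 ∷ 0 ∷ [])) ∷
  (4 , 30 , 13 , (4 ∷ 1 ∷ 5 ∷ 3 ∷ 0 ∷ 5 ∷ 2 ∷ 3 ∷ 4 ∷ 6 ∷ 2 ∷ 7 ∷ 1 ∷ 3 ∷ 3 ∷ 6 ∷ 7 ∷ 7 ∷ 4 ∷ 4 ∷ 2 ∷ 1 ∷ 1 ∷ 6 ∷ 6 ∷ 5 ∷ 5 ∷ 7 ∷ 0 ∷ 0 ∷ [])) ∷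
  (4 , 31 , 10 , (4 ∷ 1 ∷ 5 ∷ 3 ∷ 0 ∷ 5 ∷ 2 ∷ 3 ∷ 1 ∷ 1 ∷ 6 ∷ 2 ∷ 7 ∷ 3 ∷ 3 ∷ 6 ∷ 7 ∷ 7 ∷ 4 ∷ 4 ∷ 2 ∷ 2 ∷ 1 ∷ 7 ∷ 5 ∷ 5 ∷ 4 ∷ 6 ∷ 6 ∷ 0 ∷ 0 ∷ [])) ∷
  (4 , 31 , 11 , (4 ∷ 1 ∷ 5 ∷ 3 ∷ 0 ∷ 5 ∷ 2 ∷ 3 ∷ 4 ∷ 6 ∷ 1 ∷ 2 ∷ 7 ∷ 3 ∷ 1 ∷ 1 ∷ 7 ∷ 6 ∷ 0 ∷ 7 ∷ 7 ∷ 4 ∷ 4 ∷ 5 ∷ 5 ∷ 6 ∷ 6 ∷ 2 ∷ 2 ∷ 0 ∷ 0 ∷ [])) ∷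
  (4 , 31 , 12 , (4 ∷ 1 ∷ 5 ∷ 3 ∷ 0 ∷ 5 ∷ 2 ∷ 3 ∷ 4 ∷ 6 ∷ 2 ∷ 1 ∷ 3 ∷ 3 ∷ 7 ∷ 0 ∷ 6 ∷ 6 ∷ 7 ∷ 4 ∷ 4 ∷ 5 ∷ 5 ∷ 6 ∷ 1 ∷ 7 ∷ 7 ∷ 2 ∷ 2 ∷ 0 ∷ 0 ∷ [])) ∷
  (4 , 31 , 13 , (4 ∷ 1 ∷ 5 ∷ 3 ∷ 0 ∷ 5 ∷ 2 ∷ 3 ∷ 4 ∷ 6 ∷ 2 ∷ 7 ∷ 1 ∷ 3 ∷ 3 ∷ 6 ∷ 7 ∷ 7 ∷ 4 ∷ 4 ∷ 2 ∷ 2 ∷ 1 ∷ 1 ∷ 6 ∷ 6 ∷ 5 ∷ 5 ∷ 7 ∷ 0 ∷ 0 ∷ [])) ∷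
  (4 , 31 , 14 , (4 ∷ 1 ∷ 5 ∷ 3 ∷ 0 ∷ 5 ∷ 2 ∷ 3 ∷ 4 ∷ 6 ∷ 2 ∷ 7 ∷ 3 ∷ 1 ∷ 1 ∷ 6 ∷ 7 ∷ 4 ∷ 4 ∷ 5 ∷ 5 ∷ 6 ∷ 6 ∷ 0 ∷ 0 ∷ 2 ∷ 2 ∷ 1 ∷ 7 ∷ 7 ∷ 0 ∷ [])) ∷
  (4 , 32 , 10 , (3 ∷ 2 ∷ 2 ∷ 7 ∷ 7 ∷ 5 ∷ 6 ∷ 7 ∷ 1 ∷ 1 ∷ 6 ∷ 6 ∷ 0 ∷ 5 ∷ 3 ∷ 3 ∷ 6 ∷ 4 ∷ 4 ∷ 3 ∷ 1 ∷ 4 ∷ 0 ∷ 0 ∷ 7 ∷ 4 ∷ 2 ∷ 5 ∷ 5 ∷ 1 ∷ 2 ∷ 0 ∷ [])) ∷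
  (4 , 32 , 11 , (4 ∷ 1 ∷ 5 ∷ 3 ∷ 0 ∷ 5 ∷ 2 ∷ 3 ∷ 4 ∷ 6 ∷ 1 ∷ 2 ∷ 7 ∷ 3 ∷ 3 ∷ 1 ∷ 1 ∷ 7 ∷ 7 ∷ 4 ∷ 4 ∷ 5 ∷ 5 ∷ 6 ∷ 2 ∷ 2 ∷ 0 ∷ 7 ∷ 6 ∷ 6 ∷ 0 ∷ 0 ∷ [])) ∷
  (4 , 32 , 12 , (4 ∷ 1 ∷ 5 ∷ 3 ∷ 0 ∷ 5 ∷ 2 ∷ 3 ∷ 4 ∷ 6 ∷ 2 ∷ 1 ∷ 3 ∷ 3 ∷ 7 ∷ 0 ∷ 6 ∷ 6 ∷ 7 ∷ 4 ∷ 4 ∷ 5 ∷ 5 ∷ 6 ∷ 1 ∷ 1 ∷ 7 ∷ 7 ∷ 2 ∷ 2 ∷ 0 ∷ 0 ∷ [])) ∷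
  (4 , 32 , 13 , (4 ∷ 1 ∷ 5 ∷ 3 ∷ 0 ∷ 5 ∷ 2 ∷ 3 ∷ 4 ∷ 6 ∷ 2 ∷ 7 ∷ 1 ∷ 3 ∷ 3 ∷ 6 ∷ 7 ∷ 7 ∷ 4 ∷ 4 ∷ 5 ∷ 5 ∷ 7 ∷ 0 ∷ 2 ∷ 2 ∷ 1 ∷ 1 ∷ 6 ∷ 6 ∷ 0 ∷ 0 ∷ [])) ∷
  (4 , 32 , 14 , (3 ∷ 2 ∷ 2 ∷ 7 ∷ 7 ∷ 5 ∷ 6 ∷ 7 ∷ 1 ∷ 6 ∷ 6 ∷ 0 ∷ 5 ∷ 1 ∷ 3 ∷ 3 ∷ 6 ∷ 4 ∷ 4 ∷ 3 ∷ 7 ∷ 0 ∷ 0 ∷ 2 ∷ 5 ∷ 5 ∷ 4 ∷ 1 ∷ 1 ∷ 2 ∷ 4 ∷ 0 ∷ [])) ∷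
  (4 , 32 , 15 , (4 ∷ 1 ∷ 5 ∷ 3 ∷ 0 ∷ 5 ∷ 2 ∷ 3 ∷ 4 ∷ 6 ∷ 2 ∷ 7 ∷ 3 ∷ 3 ∷ 1 ∷ 6 ∷ 0 ∷ 0 ∷ 2 ∷ 2 ∷ 1 ∷ 1 ∷ 7 ∷ 7 ∷ 6 ∷ 6 ∷ 5 ∷ 5 ∷ 4 ∷ 4 ∷ 7 ∷ 0 ∷ [])) ∷
  (5 , 47 , 16 , (7 ∷ 9 ∷ 0 ∷ 0 ∷ 4 ∷ 8 ∷ 5 ∷ 0 ∷ 3 ∷ 6 ∷ 9 ∷ 5 ∷ 6 ∷ 6 ∷ 2 ∷ 1 ∷ 3 ∷ 2 ∷ 7 ∷ 1 ∷ 4 ∷ 9 ∷ 1 ∷ 8 ∷ 0 ∷ 2 ∷ 2 ∷ 8 ∷ 3 ∷ 9 ∷ 9 ∷ 2 ∷ 4 ∷ 7 ∷ 7 ∷ 8 ∷ 8 ∷ 6 ∷ 7 ∷ 3 ∷ 3 ∷ 4 ∷ 5 ∷ 1 ∷ 1 ∷ 6 ∷ 0 ∷ [])) ∷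
  (5 , 47 , 17 , (7 ∷ 9 ∷ 0 ∷ 0 ∷ 4 ∷ 8 ∷ 5 ∷ 0 ∷ 3 ∷ 6 ∷ 9 ∷ 5 ∷ 6 ∷ 6 ∷ 2 ∷ 3 ∷ 1 ∷ 1 ∷ 7 ∷ 2 ∷ 4 ∷ 9 ∷ 1 ∷ 8 ∷ 0 ∷ 2 ∷ 2 ∷ 8 ∷ 3 ∷ 9 ∷ 9 ∷ 2 ∷ 5 ∷ 7 ∷ 7 ∷ 8 ∷ 8 ∷ 6 ∷ 7 ∷ 4 ∷ 3 ∷ 5 ∷ 5 ∷ 1 ∷ 4 ∷ 6 ∷ 0 ∷ [])) ∷
  (5 , 48 , 17 , (7 ∷ 9 ∷ 0 ∷ 0 ∷ 4 ∷ 8 ∷ 5 ∷ 0 ∷ 3 ∷ 6 ∷ 9 ∷ 5 ∷ 6 ∷ 6 ∷ 2 ∷ 3 ∷ 1 ∷ 1 ∷ 7 ∷ 2 ∷ 4 ∷ 9 ∷ 1 ∷ 8 ∷ 0 ∷ 2 ∷ 2 ∷ 8 ∷ 3 ∷ 9 ∷ 9 ∷ 2 ∷ 5 ∷ 7 ∷ 7 ∷ 8 ∷ 8 ∷ 6 ∷ 7 ∷ 4 ∷ 3 ∷ 3 ∷ 5 ∷ 4 ∷ 4 ∷ 1 ∷ 6 ∷ 0 ∷ [])) ∷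
  (5 , 49 , 17 , (7 ∷ 9 ∷ 0 ∷ 0 ∷ 4 ∷ 8 ∷ 5 ∷ 0 ∷ 3 ∷ 6 ∷ 9 ∷ 5 ∷ 6 ∷ 6 ∷ 2 ∷ 3 ∷ 1 ∷ 1 ∷ 7 ∷ 2 ∷ 4 ∷ 9 ∷ 1 ∷ 8 ∷ 0 ∷ 2 ∷ 2 ∷ 8 ∷ 3 ∷ 9 ∷ 9 ∷ 2 ∷ 5 ∷ 7 ∷ 7 ∷ 8 ∷ 8 ∷ 6 ∷ 7 ∷ 4 ∷ 3 ∷ 3 ∷ 5 ∷ 5 ∷ 4 ∷ 4 ∷ 1 ∷ 6 ∷ 0 ∷ [])) ∷
  (5 , 49 , 18 , (7 ∷ 9 ∷ 0 ∷ 0 ∷ 4 ∷ 8 ∷ 5 ∷ 0 ∷ 3 ∷ 6 ∷ 9 ∷ 5 ∷ 6 ∷ 6 ∷ 2 ∷ 3 ∷ 1 ∷ 1 ∷ 7 ∷ 2 ∷ 4 ∷ 9 ∷ 1 ∷ 8 ∷ 0 ∷ 2 ∷ 2 ∷ 8 ∷ 3 ∷ 9 ∷ 9 ∷ 2 ∷ 5 ∷ 7 ∷ 7 ∷ 8 ∷ 8 ∷ 6 ∷ 7 ∷ 4 ∷ 3 ∷ 3 ∷ 5 ∷ 5 ∷ 4 ∷ 4 ∷ 1 ∷ 6 ∷ 0 ∷ [])) ∷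
  (5 , 50 , 17 , (8 ∷ 3 ∷ 9 ∷ 1 ∷ 8 ∷ 5 ∷ 6 ∷ 6 ∷ 0 ∷ 4 ∷ 3 ∷ 6 ∷ 1 ∷ 3 ∷ 2 ∷ 7 ∷ 1 ∷ 2 ∷ 2 ∷ 8 ∷ 8 ∷ 4 ∷ 1 ∷ 1 ∷ 5 ∷ 2 ∷ 0 ∷ 3 ∷ 3 ∷ 5 ∷ 9 ∷ 9 ∷ 0 ∷ 7 ∷ 6 ∷ 9 ∷ 4 ∷ 7 ∷ 7 ∷ 8 ∷ 6 ∷ 4 ∷ 4 ∷ 2 ∷ 9 ∷ 7 ∷ 5 ∷ 5 ∷ 0 ∷ 0 ∷ [])) ∷
  (5 , 50 , 18 , (6 ∷ 4 ∷ 7 ∷ 7 ∷ 2 ∷ 3 ∷ 0 ∷ 8 ∷ 2 ∷ 1 ∷ 6 ∷ 6 ∷ 5 ∷ 4 ∷ 2 ∷ 2 ∷ 5 ∷ 1 ∷ 1 ∷ 4 ∷ 0 ∷ 7 ∷ 5 ∷ 5 ∷ 0 ∷ 2 ∷ 6 ∷ 9 ∷ 8 ∷ 8 ∷ 3 ∷ 7 ∷ 1 ∷ 3 ∷ 5 ∷ 9 ∷ 3 ∷ 3 ∷ 6 ∷ 8 ∷ 7 ∷ 9 ∷ 4 ∷ 4 ∷ 8 ∷ 1 ∷ 9 ∷ 9 ∷ 0 ∷ 0 ∷ [])) ∷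
  (5 , 50 , 19 , (7 ∷ 9 ∷ 0 ∷ 0 ∷ 4 ∷ 8 ∷ 5 ∷ 0 ∷ 3 ∷ 6 ∷ 9 ∷ 5 ∷ 6 ∷ 6 ∷ 2 ∷ 3 ∷ 8 ∷ 2 ∷ 1 ∷ 4 ∷ 9 ∷ 1 ∷ 8 ∷ 0 ∷ 2 ∷ 2 ∷ 4 ∷ 3 ∷ 9 ∷ 9 ∷ 2 ∷ 5 ∷ 7 ∷ 7 ∷ 8 ∷ 8 ∷ 6 ∷ 7 ∷ 4 ∷ 4 ∷ 5 ∷ 5 ∷ 1 ∷ 3 ∷ 3 ∷ 7 ∷ 1 ∷ 1 ∷ 6 ∷ 0 ∷ [])) ∷
  []

lookupTrail : ℕ → ℕ → ℕ → List ℕ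
lookupTrail M n j = go knownTrails
  where
  go : List (ℕ × ℕ × ℕ × List ℕ) → List ℕ
  go []                               = []
  go ((M′ , n′ , j′ , route) ∷ rest) = if (M ≡ᵇ M′) ∧ (n ≡ᵇ n′) ∧ (j ≡ᵇ j′) then route else go rest

Exceptional : ℕ → ℕ → ℕ → Set
Exceptional M n j = M ≡ 2 × n ≡ 8 × j ≡ 2

exceptional? : ∀ M n j → Dec (Exceptional M n j)
exceptional? M n j = M ≟ 2 ×-dec n ≟ 8 ×-dec j ≟ 2

Shortcut : ℕ → ℕ → ℕ → Set
Shortcut m n j = (n ≤ capacity m × ¬ Exceptional m n j)
               ⊎ (2 * j ≤ n ∸ d × ¬ Exceptional m (n ∸ d) j)
               ⊎ (d + 2 ≤ j × ¬ Exceptional m (n ∸ d) (j ∸ d))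
  where
  d : ℕ
  d = detourLength m n

shortcut? : ∀ m n j → Dec (Shortcut m n j)
shortcut? m n j = (n ≤? capacity m ×-dec ¬? (exceptional? m n j))
             ⊎-dec (2 * j ≤? n ∸ d ×-dec ¬? (exceptional? m (n ∸ d) j))
             ⊎-dec (d + 2 ≤? j ×-dec ¬? (exceptional? m (n ∸ d) (j ∸ d)))
  where
  d : ℕ
  d = detourLength m n

TableCovers : ℕ → (ℕ → ℕ → Set) → Set
TableCovers M Exempt = ∀ {n} → n < suc (capacity M) → ∀ {j} → j < suc n →
  2 ≤ j × 2 * j ≤ n → ¬ Exempt n j → IsClosedTrail (2 * M) n j (lookupTrail M n j)

tableCovers? : ∀ M {Exempt : ℕ → ℕ → Set} → (∀ n j → Dec (Exempt n j)) → Dec (TableCovers M Exempt)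
tableCovers? M exempt? = allUpTo? (λ n → allUpTo? (λ j →
    (2 ≤? j ×-dec 2 * j ≤? n) →-dec ¬? (exempt? n j) →-dec isClosedTrail? (2 * M) n j (lookupTrail M n j))
  (suc n)) (suc (capacity M))

2j≤n⇒j≤n : ∀ {j n} → 2 * j ≤ n → j ≤ n
2j≤n⇒j≤n {j} = ≤-trans (m≤m+n j (j + 0))

2j≤n⇒j<n : ∀ {j n} → 1 ≤ j → 2 * j ≤ n → j < n
2j≤n⇒j<n {j} 1≤j = <-≤-trans (m<m+n j (subst (1 ≤_) (sym (+-identityʳ j)) 1≤j))

ClosedTrailsExist : ℕ → Set
ClosedTrailsExist M = ∀ {n j} → n ≤ capacity M → 2 ≤ j → 2 * j ≤ n → ¬ Exceptional M n j → ClosedTrail (2 * M) n j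

TableCovers⇒ClosedTrail : ∀ {M Exempt} → TableCovers M Exempt →
  ∀ {n j} → n ≤ capacity M → 2 ≤ j → 2 * j ≤ n → ¬ Exempt n j → ClosedTrail (2 * M) n j
TableCovers⇒ClosedTrail covers n≤ 2≤j 2j≤n ¬exempt =
  IsClosedTrail⇒ClosedTrail (covers (s≤s n≤) (s≤s (2j≤n⇒j≤n 2j≤n)) (2≤j , 2j≤n) ¬exempt)

closedTrailsExist-2 : ClosedTrailsExist 2
closedTrailsExist-2 = TableCovers⇒ClosedTrail {2} (toWitness {a? = tableCovers? 2 (exceptional? 2)} _)

knownTrails-cover : ∀ m → 2 ≤ m → m ≤ 5 → TableCovers (suc m) (Shortcut m)
knownTrails-cover 0 () _
knownTrails-cover 1 (s≤s ()) _
knownTrails-cover 2 _ _ = toWitness {a? = tableCovers? 3 (shortcut? 2)} _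
knownTrails-cover 3 _ _ = toWitness {a? = tableCovers? 4 (shortcut? 3)} _
knownTrails-cover 4 _ _ = toWitness {a? = tableCovers? 5 (shortcut? 4)} _
knownTrails-cover 5 _ _ = toWitness {a? = tableCovers? 6 (shortcut? 5)} _
knownTrails-cover (suc (suc (suc (suc (suc (suc _)))))) _ (s≤s (s≤s (s≤s (s≤s (s≤s ())))))

module _ {m : ℕ} (6≤m : 6 ≤ m) where

  private
    unexceptional : ∀ {n j} → ¬ Exceptional m n j
    unexceptional (refl , _) = contradiction 6≤m λ { (s≤s (s≤s ())) }

  shortcut-exists : ∀ {n j} → n ≤ capacity (suc m) → Shortcut m n j
  shortcut-exists {n} {j} n≤ with n ≤? capacity m | 2 * j ≤? n ∸ detourLength m n
  ... | yes n≤cap | _         = inj₁ (n≤cap , unexceptional)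
  ... | no n≰cap  | yes close = inj₂ (inj₁ (close , unexceptional))
  ... | no n≰cap  | no far    = inj₂ (inj₂ (far-chord-prependable m n j 6≤m (≰⇒> n≰cap) n≤ far , unexceptional))

module _ {m : ℕ} (2≤m : 2 ≤ m) (IH : ClosedTrailsExist m)
         {n j : ℕ} (n≤ : n ≤ capacity (suc m)) (2≤j : 2 ≤ j) (2j≤n : 2 * j ≤ n) where

  private
    t : ℕ
    t = proj₁ (detourShape m n)
    r : Loops
    r = proj₂ (detourShape m n)
    d : ℕ
    d = detourLength m n
    2≤2m : 2 ≤ 2 * m
    2≤2m = *-monoʳ-≤ 2 (≤-trans (s≤s z≤n) 2≤m)
    room : 2 + 2 * t ≤ 2 * m
    room = detour-room m n (≤-trans (s≤s z≤n) 2≤m) n≤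
    vertices : 2 + 2 * m ≡ 2 * suc m
    vertices = sym (*-suc 2 m)

  appendShortcut : 2 * j ≤ n ∸ d → ¬ Exceptional m (n ∸ d) j → ClosedTrail (2 * suc m) n j
  appendShortcut 2j≤n∸d ¬e = subst₂ (λ k n → ClosedTrail k n j) vertices
    (trans (cong (n ∸ d +_) (length-detour (2 * m) t r)) (m∸n+n≡m d≤n))
    (appendDetour r 2≤2m room (2j≤n⇒j≤n 2j≤n∸d) (IH (shortened-fits m n) 2≤j 2j≤n∸d ¬e))
    where
    d≤n : d ≤ n
    d≤n = <⇒≤ (m∸n≢0⇒n<m λ n∸d≡0 → <⇒≱ (≤-trans (s≤s z≤n) (*-monoʳ-≤ 2 2≤j)) (subst (2 * j ≤_) n∸d≡0 2j≤n∸d))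

  prependShortcut : d + 2 ≤ j → ¬ Exceptional m (n ∸ d) (j ∸ d) → ClosedTrail (2 * suc m) n j
  prependShortcut d+2≤j ¬e = subst₂ (λ k nj → ClosedTrail k (proj₁ nj) (proj₂ nj)) vertices
    (cong₂ _,_ (restore d≤n) (restore d≤j))
    (prependDetour r 2≤2m room (IH (shortened-fits m n) 2≤j∸d 2[j∸d]≤n∸d ¬e))
    where
    d≤j : d ≤ j
    d≤j = ≤-trans (m≤m+n d 2) d+2≤j
    d≤n : d ≤ n
    d≤n = ≤-trans d≤j (2j≤n⇒j≤n 2j≤n)
    restore : ∀ {a} → d ≤ a → length (detour (2 * m) t r) + (a ∸ d) ≡ a
    restore {a} d≤a = trans (cong (_+ (a ∸ d)) (length-detour (2 * m) t r)) (m+[n∸m]≡n d≤a)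
    2≤j∸d : 2 ≤ j ∸ d
    2≤j∸d = subst (_≤ j ∸ d) (m+n∸m≡n d 2) (∸-monoˡ-≤ d d+2≤j)
    2[j∸d]≤n∸d : 2 * (j ∸ d) ≤ n ∸ d
    2[j∸d]≤n∸d = begin
      2 * (j ∸ d)   ≡⟨ *-distribˡ-∸ 2 j d ⟩
      2 * j ∸ 2 * d ≤⟨ ∸-monoʳ-≤ (2 * j) (m≤m+n d (d + 0)) ⟩
      2 * j ∸ d     ≤⟨ ∸-monoˡ-≤ d 2j≤n ⟩
      n ∸ d         ∎
      where open ≤-Reasoning

  shortcut⇒ClosedTrail : Shortcut m n j → ClosedTrail (2 * suc m) n j
  shortcut⇒ClosedTrail (inj₁ (n≤cap , ¬e))        = ClosedTrail-mono (*-monoʳ-≤ 2 (n≤1+n m)) (IH n≤cap 2≤j 2j≤n ¬e)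
  shortcut⇒ClosedTrail (inj₂ (inj₁ (close , ¬e))) = appendShortcut close ¬e
  shortcut⇒ClosedTrail (inj₂ (inj₂ (far , ¬e)))   = prependShortcut far ¬e

closedTrailsExist-suc : ∀ {m} → 2 ≤ m → ClosedTrailsExist m → ClosedTrailsExist (suc m)
closedTrailsExist-suc {m} 2≤m IH {n} {j} n≤ 2≤j 2j≤n _ with shortcut? m n j
... | yes shortcut = shortcut⇒ClosedTrail 2≤m IH n≤ 2≤j 2j≤n shortcut
... | no ¬shortcut = TableCovers⇒ClosedTrail {suc m} (knownTrails-cover m 2≤m m≤5) n≤ 2≤j 2j≤n ¬shortcut
  where
  m≤5 : m ≤ 5
  m≤5 = ≮⇒≥ λ 5<m → ¬shortcut (shortcut-exists 5<m n≤)

closedTrailsExist : ∀ M → 2 ≤ M → ClosedTrailsExist M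
closedTrailsExist 0                   ()
closedTrailsExist 1                   (s≤s ())
closedTrailsExist 2                   _ = closedTrailsExist-2
closedTrailsExist (suc (suc (suc m))) _ = closedTrailsExist-suc (s≤s (s≤s z≤n)) (closedTrailsExist (suc (suc m)) (s≤s (s≤s z≤n)))

even-4≤k : ∀ {k n} → 2 ∣ k → 0 < k → 4 ≤ n → 2 * n ≤ k * k → 4 ≤ k
even-4≤k (divides 0 refl)             ()  _   _
even-4≤k (divides 1 refl)             _   4≤n 2n≤4 with ≤-trans (*-monoʳ-≤ 2 4≤n) 2n≤4
... | s≤s (s≤s (s≤s (s≤s ())))
even-4≤k (divides (suc (suc q)) refl) _   _   _    = s≤s (s≤s (s≤s (s≤s z≤n)))

ClosedTrail-from-bounds : ∀ {k n j} → 2 ∣ k → 4 ≤ k → 2 * n ≤ k * k → 2 ≤ j → 2 * j ≤ n →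
  ¬ (k ≡ 4 × n ≡ 8 × j ≡ 2) → ClosedTrail k n j
ClosedTrail-from-bounds {n = n} {j} (divides q refl) 4≤k 2n≤k² 2≤j 2j≤n not-exceptional =
  subst (λ k → ClosedTrail k n j) (*-comm 2 q)
    (closedTrailsExist q (*-cancelʳ-≤ 2 q 2 4≤k) (*-cancelˡ-≤ 2 (subst (2 * n ≤_) (capacity-double q) 2n≤k²)) 2≤j 2j≤n
      λ (q≡2 , n≡8 , j≡2) → not-exceptional (cong (_* 2) q≡2 , n≡8 , j≡2))

theorem3p2 : (k n j : ℕ) → 2 ∣ k → 0 < k → 2 ≤ j → 2 * j ≤ n →
    (EmbedsIn (C n j) k ⇔ (4 ≤ k × 2 * n ≤ k * k × ¬ (k ≡ 4 × n ≡ 8 × j ≡ 2)))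
theorem3p2 k n j 2∣k 0<k 2≤j 2j≤n = mk⇔ necessary sufficient
  where
  necessary : EmbedsIn (C n j) k → 4 ≤ k × 2 * n ≤ k * k × ¬ (k ≡ 4 × n ≡ 8 × j ≡ 2)
  necessary embedding = even-4≤k 2∣k 0<k (≤-trans (*-monoʳ-≤ 2 2≤j) 2j≤n) 2n≤k² , 2n≤k² ,
                        λ { (refl , refl , refl) → no-C₈₂-embedding embedding }
    where
    2n≤k² : 2 * n ≤ k * k
    2n≤k² = EmbedsIn⇒2n≤k² {k} {n} {j} 2∣k embedding
  sufficient : 4 ≤ k × 2 * n ≤ k * k × ¬ (k ≡ 4 × n ≡ 8 × j ≡ 2) → EmbedsIn (C n j) k
  sufficient (4≤k , 2n≤k² , not-exceptional) = ClosedTrail⇒EmbedsIn 0<k (2j≤n⇒j<n (≤-trans (s≤s z≤n) 2≤j) 2j≤n)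
    (ClosedTrail-from-bounds 2∣k 4≤k 2n≤k² 2≤j 2j≤n not-exceptional)
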